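{- Let $G$ be a graph of genus $g\le 3$. Then the gonality of $G$ is at most $\lfloor (g+3)/2\rfloor$.
   Context: A graph is a finite connected multigraph without loop edges; its genus is $g=|E(G)|-|V(G)|+1$. $\mathrm{Div}(G)$ is the free abelian group on $V(G)$; for $\varphi:V(G)\to\mathbb Z$, $\Delta(\varphi)=\sum_v\sum_{e=vw\in E(G)}(\varphi(v)-\varphi(w))(v)$; $D\sim D'$ iff $D-D'=\Delta(\varphi)$ for some $\varphi$; $|D|=\{E\ge0:E\sim D\}$; $r(D)=-1$ if $|D|=\emptyset$, otherwise $r(D)$ is the maximal $k$ such that $|D-E|\ne\emptyset$ for every effective divisor $E$ of degree $k$. The gonality of $G$ is the smallest positive integer $d$ such that there exists $D\in\mathrm{Div}(G)$ with $\deg D=d$ and $r(D)=1$. -}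

module Defs where

open import Data.Nat using (ℕ; zero; suc; _≤_; _∸_) renaming (_+_ to _+ℕ_)
open import Data.Nat.DivMod using (_/_)
open import Data.Integer using (ℤ; +_; _+_; _-_) renaming (_≤_ to _≤ℤ_)
open import Data.Fin using (Fin; zero; suc)
open import Data.List using (List; []; _∷_; length)
open import Data.List.Relation.Unary.All using (All)
open import Data.List.Membership.Propositional using (_∈_)
open import Data.Product using (Σ; _×_; _,_; ∃; ∃-syntax)
open import Relation.Nullary using (¬_)
open import Relation.Binary.PropositionalEquality using (_≡_; _≢_)
open import Data.Bool using (if_then_else_)
open import Data.Fin using (_≟_)
open import Relation.Nullary.Decidable using (⌊_⌋)

-- A finite multigraph on vertex set Fin n, given by a list of edges
-- (an edge is an unordered pair, stored as an ordered pair (a , b);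
-- repeated entries are parallel edges).
record Graph : Set where
  field
    n     : ℕ
    edges : List (Fin n × Fin n)
open Graph public

LoopFree : Graph → Set
LoopFree G = All (λ e → Data.Product.proj₁ e ≢ Data.Product.proj₂ e) (edges G)

data Reachable (G : Graph) : Fin (n G) → Fin (n G) → Set where
  here  : ∀ {u} → Reachable G u u
  fwd   : ∀ {u v w} → (u , v) ∈ edges G → Reachable G v w → Reachable G u w
  bwd   : ∀ {u v w} → (v , u) ∈ edges G → Reachable G v w → Reachable G u w

Connected : Graph → Set
Connected G = (1 ≤ n G) × (∀ u v → Reachable G u v)

-- genus |E| - |V| + 1  (exact in ℕ for connected graphs, since |E| ≥ |V| - 1)
genus : Graph → ℕ
genus G = (length (edges G) +ℕ 1) ∸ n G

Div : Graph → Set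
Div G = Fin (n G) → ℤ

sumFin : ∀ k → (Fin k → ℤ) → ℤ
sumFin zero    f = + 0
sumFin (suc k) f = f zero + sumFin k (λ i → f (suc i))

deg : (G : Graph) → Div G → ℤ
deg G D = sumFin (n G) D

Effective : (G : Graph) → Div G → Set
Effective G D = ∀ v → + 0 ≤ℤ D v

-- Laplacian: Δ(φ)(v) = Σ_{e = vw} (φ v - φ w)
private
  δ : ∀ {k} → (Fin k → ℤ) → Fin k → Fin k × Fin k → ℤ
  δ φ v (a , b) =
    (if ⌊ a ≟ v ⌋ then φ a - φ b else + 0) + (if ⌊ b ≟ v ⌋ then φ b - φ a else + 0)

  sumEdges : ∀ {k} → (Fin k → ℤ) → Fin k → List (Fin k × Fin k) → ℤ
  sumEdges φ v []       = + 0
  sumEdges φ v (e ∷ es) = δ φ v e + sumEdges φ v es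

Δ : (G : Graph) → (Fin (n G) → ℤ) → Div G
Δ G φ v = sumEdges φ v (edges G)

_-D_ : ∀ {G : Graph} → Div G → Div G → Div G
(D -D D') v = D v - D' v

LinEq : (G : Graph) → Div G → Div G → Set
LinEq G D D' = ∃[ φ ] (∀ v → (_-D_ {G} D D') v ≡ Δ G φ v)

LinSysNonempty : (G : Graph) → Div G → Set
LinSysNonempty G D = ∃[ E ] (Effective G E × LinEq G E D)

RankProp : (G : Graph) → Div G → ℕ → Set
RankProp G D k = ∀ E → Effective G E → deg G E ≡ + k → LinSysNonempty G (_-D_ {G} D E)

RankEq : (G : Graph) → Div G → ℕ → Set
RankEq G D k = LinSysNonempty G D × RankProp G D k × (∀ m → RankProp G D m → m ≤ k)

HasRank1Of : Graph → ℕ → Set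
HasRank1Of G d = ∃[ D ] (deg G D ≡ + d × RankEq G D 1)

IsGonality : Graph → ℕ → Set
IsGonality G d = (1 ≤ d) × HasRank1Of G d × (∀ d' → 1 ≤ d' → HasRank1Of G d' → d ≤ d')

-- Every divisor is equivalent to a q-reduced one, reached by legal set-firings and certified by
-- Dhar's burning order; a reduced divisor is either effective or lies strictly below the indegree
-- divisor of an acyclic orientation, and no divisor below an acyclic orientation is equivalent to
-- an effective one. Counting degrees gives |D| ≠ ∅ when deg D ≥ g and |K - F| ≠ ∅ for effective F
-- of degree g - 1, so (q), 2(q), K and K - (q) have rank one for g = 0, 1, 2, 3, except that for
-- g = 3 some degree-two divisor may already have rank one; this is decidable, as effective
-- divisors of degree two are pairs of points. For g ≥ 1 no divisor of degree one has rank one.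
module Submission where

open import Defs

module ChipFiring where

  open import Data.Bool using (Bool; true; false; not; _∨_; if_then_else_) renaming (_≟_ to _≟ᵇ_)
  open import Data.Bool.Properties using (¬-not; not-involutive; ∨-identityʳ; ∨-zeroʳ; ∨-conicalˡ)
  open import Data.Empty using (⊥; ⊥-elim)
  open import Data.Fin using (Fin; zero; suc; _≟_; toℕ)
  open import Data.Fin.Properties using (suc-injective; toℕ-injective; any?; all?; ¬∀⟶∃¬)
  open import Data.Integer
    using (ℤ; +_; -[1+_]; _+_; _-_; _*_; -_; _≤_; _<_; _≤?_; _<?_; +≤+; -≤+; +<+; -<+; ∣_∣)
  import Data.Integer.Properties as ℤ
  open import Data.Integer.Tactic.RingSolver using (solve-∀)
  open import Data.List using (List; []; _∷_; length; lookup; allFin; filter; map)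
  open import Data.List.Extrema ℤ.≤-totalOrder
    using (argmin; argmax; f[argmin]≤f[xs]; f[xs]≤f[argmax]; argmax-all)
  open import Data.List.Extrema.Nat using (max; xs≤max)
  open import Data.List.Membership.Propositional using (_∈_)
  open import Data.List.Membership.Propositional.Properties using (∈-lookup; ∈-allFin; ∈-filter⁺; ∈-map⁺)
  import Data.List.Relation.Unary.All as All
  open import Data.List.Relation.Unary.All.Properties using (all-filter)
  open import Data.List.Relation.Unary.Any using (index)
  open import Data.List.Relation.Unary.Any.Properties using (lookup-index)
  open import Data.Nat as ℕ using (ℕ; zero; suc; z≤n; s≤s)
  open import Data.Nat.DivMod using (_/_)
  import Data.Nat.Properties as ℕₚ
  open import Data.Product using (Σ; _×_; _,_; proj₁; proj₂; ∃-syntax)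
  open import Data.Product.Properties using (≡-dec)
  open import Data.Sum using (_⊎_; inj₁; inj₂)
  open import Function using (_∘_; _⇔_; mk⇔)
  open import Function.Definitions using (Injective)
  open import Relation.Binary.PropositionalEquality
  open import Relation.Nullary using (¬_; Dec; yes; no; does)
  open import Relation.Nullary.Decidable as Dec using (⌊_⌋; dec-true; dec-false; does-⇔; _×-dec_; _⊎-dec_)
  open import Algebra.Properties.CommutativeSemigroup ℤ.+-commutativeSemigroup using (interchange)

  𝟙 : Bool → ℤ
  𝟙 true  = + 1
  𝟙 false = + 0

  0≤𝟙 : ∀ b → + 0 ≤ 𝟙 b
  0≤𝟙 true  = +≤+ z≤n
  0≤𝟙 false = +≤+ z≤n

  𝟙≤𝟙 : ∀ {b c} → (b ≡ true → c ≡ true) → 𝟙 b ≤ 𝟙 c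
  𝟙≤𝟙 {false} {c}     _   = 0≤𝟙 c
  𝟙≤𝟙 {true}  {true}  _   = ℤ.≤-refl
  𝟙≤𝟙 {true}  {false} b⇒c with b⇒c refl
  ... | ()

  does-true : ∀ {A : Set} (a? : Dec A) → does a? ≡ true → A
  does-true (yes a) _ = a

  does-false : ∀ {A : Set} (a? : Dec A) → does a? ≡ false → ¬ A
  does-false (no ¬a) _ = ¬a

  𝟙[<]+𝟙[>]≤1 : ∀ x y → 𝟙 (does (x <? y)) + 𝟙 (does (y <? x)) ≤ + 1
  𝟙[<]+𝟙[>]≤1 x y with x <? y | y <? x
  ... | yes x<y | yes y<x = ⊥-elim (ℤ.<-asym x<y y<x)
  ... | yes _   | no _    = ℤ.≤-refl
  ... | no _    | yes _   = ℤ.≤-refl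
  ... | no _    | no _    = +≤+ z≤n

  𝟙[<]+𝟙[>]≡1 : ∀ {x y} → x ≢ y → 𝟙 (does (x <? y)) + 𝟙 (does (y <? x)) ≡ + 1
  𝟙[<]+𝟙[>]≡1 {x} {y} x≢y with x <? y | y <? x
  ... | yes x<y | yes y<x = ⊥-elim (ℤ.<-asym x<y y<x)
  ... | yes _   | no _    = refl
  ... | no _    | yes _   = refl
  ... | no x≮y  | no y≮x  = ⊥-elim (x≢y (ℤ.≤-antisym (ℤ.≮⇒≥ y≮x) (ℤ.≮⇒≥ x≮y)))

  does-neg-< : ∀ x y → does (- x <? - y) ≡ does (y <? x)
  does-neg-< x y = does-⇔ (mk⇔ ℤ.neg-cancel-< ℤ.neg-mono-<) (- x <? - y) (y <? x)

  i≤∣i∣ : ∀ i → i ≤ + ∣ i ∣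
  i≤∣i∣ (+ n)    = ℤ.≤-refl
  i≤∣i∣ -[1+ n ] = -≤+

  -i≤∣i∣ : ∀ i → - i ≤ + ∣ i ∣
  -i≤∣i∣ (+ zero)   = ℤ.≤-refl
  -i≤∣i∣ (+ suc n)  = -≤+
  -i≤∣i∣ -[1+ n ]   = ℤ.≤-refl

  0≤i*j : ∀ {i j} → + 0 ≤ i → + 0 ≤ j → + 0 ≤ i * j
  0≤i*j {+ m} {+ n} _ _ = subst (+ 0 ≤_) (ℤ.pos-* m n) (+≤+ z≤n)

  i≤i*j : ∀ {i j} → + 0 ≤ i → + 1 ≤ j → i ≤ i * j
  i≤i*j {i} {j} 0≤i 1≤j =
    ℤ.0≤i-j⇒j≤i (subst (+ 0 ≤_) (expand i j) (0≤i*j 0≤i (ℤ.i≤j⇒0≤j-i 1≤j)))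
    where
    expand : ∀ i j → i * (j - + 1) ≡ i * j - i
    expand = solve-∀

  𝟙*≤∣∣ : ∀ s a → 𝟙 s * a ≤ + ∣ a ∣
  𝟙*≤∣∣ true  a = subst (_≤ + ∣ a ∣) (sym (ℤ.*-identityˡ a)) (i≤∣i∣ a)
  𝟙*≤∣∣ false a = +≤+ z≤n

  0≤𝟙* : ∀ s {a} → (s ≡ true → + 0 ≤ a) → + 0 ≤ 𝟙 s * a
  0≤𝟙* true  {a} 0≤a = subst (+ 0 ≤_) (sym (ℤ.*-identityˡ a)) (0≤a refl)
  0≤𝟙* false     _   = ℤ.≤-refl

  i≤i+j : ∀ x {y} → + 0 ≤ y → x ≤ x + y
  i≤i+j x 0≤y = subst (_≤ x + _) (ℤ.+-identityʳ x) (ℤ.+-monoʳ-≤ x 0≤y)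

  i-j≤i : ∀ i {j} → + 0 ≤ j → i - j ≤ i
  i-j≤i i 0≤j = subst (i - _ ≤_) (ℤ.+-identityʳ i) (ℤ.+-monoʳ-≤ i (ℤ.neg-mono-≤ 0≤j))

  i-1<i : ∀ i → i - + 1 < i
  i-1<i i = ℤ.i≤pred[j]⇒i<j (ℤ.≤-reflexive (ℤ.+-comm i -[1+ 0 ]))

  i<j⇒i-j≤-1 : ∀ {i j} → i < j → i - j ≤ -[1+ 0 ]
  i<j⇒i-j≤-1 {i} {j} i<j =
    subst (_≤ -[1+ 0 ]) (shift i j) (ℤ.+-monoˡ-≤ -[1+ 0 ] (ℤ.i≤j⇒i-j≤0 (ℤ.i<j⇒suc[i]≤j i<j)))
    where
    shift : ∀ i j → (+ 1 + i - j) + -[1+ 0 ] ≡ i - j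
    shift = solve-∀

  -i≤j⇒0≤i+j : ∀ {i j} → - i ≤ j → + 0 ≤ i + j
  -i≤j⇒0≤i+j {i} {j} -i≤j = subst (+ 0 ≤_) (rearrange i j) (ℤ.i≤j⇒0≤j-i -i≤j)
    where
    rearrange : ∀ i j → j - - i ≡ i + j
    rearrange = solve-∀

  i-j≤k⇒i≤j+k : ∀ {i j k} → i - j ≤ k → i ≤ j + k
  i-j≤k⇒i≤j+k {i} {j} {k} i-j≤k = subst₂ _≤_ (cancel i j) (ℤ.+-comm k j) (ℤ.+-monoˡ-≤ j i-j≤k)
    where
    cancel : ∀ i j → i - j + j ≡ i
    cancel = solve-∀

  j+i≤k⇒i≤k-j : ∀ {i j k} → j + i ≤ k → i ≤ k - j
  j+i≤k⇒i≤k-j {i} {j} {k} j+i≤k = subst (_≤ k - j) (cancel j i) (ℤ.+-monoˡ-≤ (- j) j+i≤k)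
    where
    cancel : ∀ j i → j + i - j ≡ i
    cancel = solve-∀

  𝟙-cut : ∀ s t {x y} → (s ≡ true → t ≡ false → x ≤ y) → (t ≡ true → s ≡ false → y ≤ x) →
          𝟙 s * (x - y) + 𝟙 t * (y - x) ≤ + 0
  𝟙-cut true  true  {x} {y} _   _   = ℤ.≤-reflexive (cancel x y)
    where
    cancel : ∀ x y → + 1 * (x - y) + + 1 * (y - x) ≡ + 0
    cancel = solve-∀
  𝟙-cut true  false {x} {y} x≤y _   = subst (_≤ + 0) (sym (only x y)) (ℤ.i≤j⇒i-j≤0 (x≤y refl refl))
    where
    only : ∀ x y → + 1 * (x - y) + + 0 * (y - x) ≡ x - y
    only = solve-∀
  𝟙-cut false true  {x} {y} _   y≤x = subst (_≤ + 0) (sym (only x y)) (ℤ.i≤j⇒i-j≤0 (y≤x refl refl))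
    where
    only : ∀ x y → + 0 * (x - y) + + 1 * (y - x) ≡ y - x
    only = solve-∀
  𝟙-cut false false {x} {y} _   _   = ℤ.≤-reflexive (none x y)
    where
    none : ∀ x y → + 0 * (x - y) + + 0 * (y - x) ≡ + 0
    none = solve-∀

  𝟙-select : ∀ {s t} → s ≡ true → t ≡ false → ∀ {a b} → 𝟙 s * a + 𝟙 t * b ≡ a
  𝟙-select refl refl {a} {b} = only a b
    where
    only : ∀ a b → + 1 * a + + 0 * b ≡ a
    only = solve-∀

  -- Spelled with ⌊_⌋, like Defs' Δ, so that Δ≡nbrSum holds by unfolding.
  mass : ∀ {k} → Fin k → ℤ → Fin k → ℤ
  mass a x v = if ⌊ a ≟ v ⌋ then x else + 0

  mass-self : ∀ {k} (a : Fin k) x → mass a x a ≡ x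
  mass-self a x with a ≟ a
  ... | yes _   = refl
  ... | no a≢a  = ⊥-elim (a≢a refl)

  mass-other : ∀ {k} {a v : Fin k} x → a ≢ v → mass a x v ≡ + 0
  mass-other {a = a} {v} x a≢v with a ≟ v
  ... | yes a≡v = ⊥-elim (a≢v a≡v)
  ... | no _    = refl

  mass-zero : ∀ {k} (a v : Fin k) → mass a (+ 0) v ≡ + 0
  mass-zero a v with a ≟ v
  ... | yes _ = refl
  ... | no _  = refl

  mass-+ : ∀ {k} (a v : Fin k) x y → mass a (x + y) v ≡ mass a x v + mass a y v
  mass-+ a v x y with a ≟ v
  ... | yes _ = refl
  ... | no _  = refl

  mass-*ˡ : ∀ {k} (a v : Fin k) c x → mass a (c * x) v ≡ c * mass a x v
  mass-*ˡ a v c x with a ≟ v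
  ... | yes _ = refl
  ... | no _  = sym (ℤ.*-zeroʳ c)

  0≤mass : ∀ {k} (a v : Fin k) {x} → (a ≡ v → + 0 ≤ x) → + 0 ≤ mass a x v
  0≤mass a v 0≤x with a ≟ v
  ... | yes a≡v = 0≤x a≡v
  ... | no _    = ℤ.≤-refl

  mass-mono : ∀ {k} (a v : Fin k) {x y} → (a ≡ v → x ≤ y) → mass a x v ≤ mass a y v
  mass-mono a v x≤y with a ≟ v
  ... | yes a≡v = x≤y a≡v
  ... | no _    = ℤ.≤-refl

  mass-cong : ∀ {k} (a v : Fin k) {x y} → (a ≡ v → x ≡ y) → mass a x v ≡ mass a y v
  mass-cong a v x≡y with a ≟ v
  ... | yes a≡v = x≡y a≡v
  ... | no _    = refl

  sumFin-cong : ∀ k {f g : Fin k → ℤ} → (∀ i → f i ≡ g i) → sumFin k f ≡ sumFin k g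
  sumFin-cong zero    f≗g = refl
  sumFin-cong (suc k) f≗g = cong₂ _+_ (f≗g zero) (sumFin-cong k (f≗g ∘ suc))

  sumFin-+ : ∀ k (f g : Fin k → ℤ) → sumFin k (λ i → f i + g i) ≡ sumFin k f + sumFin k g
  sumFin-+ zero    f g = refl
  sumFin-+ (suc k) f g = trans (cong (_+_ (f zero + g zero)) (sumFin-+ k (f ∘ suc) (g ∘ suc)))
                               (interchange (f zero) (g zero) _ _)

  sumFin-*ˡ : ∀ k c (f : Fin k → ℤ) → sumFin k (λ i → c * f i) ≡ c * sumFin k f
  sumFin-*ˡ zero    c f = sym (ℤ.*-zeroʳ c)
  sumFin-*ˡ (suc k) c f = trans (cong (_+_ (c * f zero)) (sumFin-*ˡ k c (f ∘ suc)))
                                (sym (ℤ.*-distribˡ-+ c (f zero) _))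

  sumFin-neg : ∀ k (f : Fin k → ℤ) → sumFin k (λ i → - f i) ≡ - sumFin k f
  sumFin-neg zero    f = refl
  sumFin-neg (suc k) f = trans (cong (_+_ (- f zero)) (sumFin-neg k (f ∘ suc)))
                               (sym (ℤ.neg-distrib-+ (f zero) _))

  sumFin-sub : ∀ k (f g : Fin k → ℤ) → sumFin k (λ i → f i - g i) ≡ sumFin k f - sumFin k g
  sumFin-sub k f g = trans (sumFin-+ k f (λ i → - g i)) (cong (_+_ (sumFin k f)) (sumFin-neg k g))

  sumFin-const : ∀ k c → sumFin k (λ _ → c) ≡ + k * c
  sumFin-const zero    c = sym (ℤ.*-zeroˡ c)
  sumFin-const (suc k) c = trans (cong (_+_ c) (sumFin-const k c)) (sym (ℤ.suc-* (+ k) c))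

  sumFin-zero : ∀ k → sumFin k (λ _ → + 0) ≡ + 0
  sumFin-zero k = trans (sumFin-const k (+ 0)) (ℤ.*-zeroʳ (+ k))

  sumFin-one : ∀ k → sumFin k (λ _ → + 1) ≡ + k
  sumFin-one k = trans (sumFin-const k (+ 1)) (ℤ.*-identityʳ (+ k))

  sumFin-*ʳ : ∀ k (f : Fin k → ℤ) c → sumFin k (λ i → f i * c) ≡ sumFin k f * c
  sumFin-*ʳ k f c = trans (sumFin-cong k (λ i → ℤ.*-comm (f i) c)) (trans (sumFin-*ˡ k c f) (ℤ.*-comm c _))

  sumFin-mono : ∀ k {f g : Fin k → ℤ} → (∀ i → f i ≤ g i) → sumFin k f ≤ sumFin k g
  sumFin-mono zero    f≤g = ℤ.≤-refl
  sumFin-mono (suc k) f≤g = ℤ.+-mono-≤ (f≤g zero) (sumFin-mono k (f≤g ∘ suc))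

  sumFin-nonneg : ∀ k {f : Fin k → ℤ} → (∀ i → + 0 ≤ f i) → + 0 ≤ sumFin k f
  sumFin-nonneg k {f} 0≤f = subst (_≤ sumFin k f) (sumFin-zero k) (sumFin-mono k 0≤f)

  term≤sumFin : ∀ k {f : Fin k → ℤ} → (∀ i → + 0 ≤ f i) → ∀ a → f a ≤ sumFin k f
  term≤sumFin (suc k) {f} 0≤f zero    = i≤i+j (f zero) (sumFin-nonneg k (0≤f ∘ suc))
  term≤sumFin (suc k) {f} 0≤f (suc a) = ℤ.≤-trans (term≤sumFin k (0≤f ∘ suc) a)
    (subst (_≤ f zero + sumFin k (f ∘ suc)) (ℤ.+-identityˡ _)
           (ℤ.+-monoˡ-≤ (sumFin k (f ∘ suc)) (0≤f zero)))

  sumFin≤term : ∀ k {f : Fin k → ℤ} → (∀ i → f i ≤ + 0) → ∀ a → sumFin k f ≤ f a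
  sumFin≤term k {f} f≤0 a =
    subst₂ _≤_ (trans (cong -_ (sumFin-neg k f)) (ℤ.neg-involutive _)) (ℤ.neg-involutive (f a))
      (ℤ.neg-mono-≤ (term≤sumFin k (λ i → ℤ.neg-mono-≤ (f≤0 i)) a))

  sumFin-single : ∀ k {f : Fin k → ℤ} a → (∀ v → v ≢ a → f v ≡ + 0) → sumFin k f ≡ f a
  sumFin-single (suc k) {f} zero    f0 = trans (cong (_+_ (f zero))
    (trans (sumFin-cong k (λ i → f0 (suc i) λ ())) (sumFin-zero k))) (ℤ.+-identityʳ _)
  sumFin-single (suc k) {f} (suc a) f0 = trans (cong₂ _+_ (f0 zero λ ())
    (sumFin-single k a (λ i i≢a → f0 (suc i) (i≢a ∘ suc-injective)))) (ℤ.+-identityˡ _)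

  sumFin-mass : ∀ k (w : Fin k → ℤ) a x → sumFin k (λ v → w v * mass a x v) ≡ w a * x
  sumFin-mass k w a x = trans
    (sumFin-single k a λ v v≢a → trans (cong (w v *_) (mass-other x (v≢a ∘ sym))) (ℤ.*-zeroʳ (w v)))
    (cong (w a *_) (mass-self a x))

  sumFin-comm : ∀ k l (f : Fin k → Fin l → ℤ) →
                sumFin k (λ i → sumFin l (f i)) ≡ sumFin l (λ j → sumFin k (λ i → f i j))
  sumFin-comm zero    l f = sym (sumFin-zero l)
  sumFin-comm (suc k) l f = trans (cong (_+_ (sumFin l (f zero))) (sumFin-comm k l (f ∘ suc)))
                                  (sym (sumFin-+ l (f zero) _))

  sumFin-strict : ∀ k {f g : Fin k → ℤ} → (∀ i → f i ≤ g i) → ∀ a → f a < g a →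
                  sumFin k f < sumFin k g
  sumFin-strict (suc k) f≤g zero    fa<ga = ℤ.+-mono-<-≤ fa<ga (sumFin-mono k (f≤g ∘ suc))
  sumFin-strict (suc k) f≤g (suc a) fa<ga = ℤ.+-mono-≤-< (f≤g zero) (sumFin-strict k (f≤g ∘ suc) a fa<ga)

  sumFin-tight : ∀ k {f g : Fin k → ℤ} → (∀ i → f i ≤ g i) → sumFin k g ≤ sumFin k f →
                 ∀ i → f i ≡ g i
  sumFin-tight k {f} {g} f≤g Σg≤Σf i = ℤ.≤-antisym (f≤g i) (ℤ.i-j≤0⇒i≤j (begin
    g i - f i                     ≤⟨ term≤sumFin k (λ j → ℤ.i≤j⇒0≤j-i (f≤g j)) i ⟩
    sumFin k (λ j → g j - f j)    ≡⟨ sumFin-sub k g f ⟩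
    sumFin k g - sumFin k f       ≤⟨ ℤ.i≤j⇒i-j≤0 Σg≤Σf ⟩
    + 0                           ∎))
    where open ℤ.≤-Reasoning

  descend : ∀ {A : Set} (P Q : A → Set) (μ : A → ℤ) → (∀ a → P a → + 0 ≤ μ a) →
            (∀ a → P a → Q a ⊎ ∃[ b ] (P b × μ b < μ a)) → ∀ a → P a → ∃[ b ] (P b × Q b)
  descend P Q μ 0≤μ step a Pa = go (suc ∣ μ a ∣) a Pa ℕₚ.≤-refl
    where
    go : ∀ fuel a → P a → ∣ μ a ∣ ℕ.< fuel → ∃[ b ] (P b × Q b)
    go (suc fuel) a Pa μa<fuel with step a Pa
    ... | inj₁ Qa              = a , Pa , Qa
    ... | inj₂ (b , Pb , μb<μa) = go fuel b Pb (ℕₚ.<-≤-trans ∣μb∣<∣μa∣ (ℕₚ.≤-pred μa<fuel))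
      where
      ∣μb∣<∣μa∣ : ∣ μ b ∣ ℕ.< ∣ μ a ∣
      ∣μb∣<∣μa∣ = ℤ.drop‿+<+
        (subst₂ _<_ (sym (ℤ.0≤i⇒+∣i∣≡i (0≤μ b Pb))) (sym (ℤ.0≤i⇒+∣i∣≡i (0≤μ a Pa))) μb<μa)

  module Divisors (G : Graph) where

    V : Set
    V = Fin (n G)

    open import Data.List.Membership.DecPropositional (≡-dec (_≟_ {n G}) (_≟_ {n G})) using (_∈?_)

    #E : ℕ
    #E = length (edges G)

    edge : Fin #E → V × V
    edge = lookup (edges G)

    Adjacent : V → V → Set
    Adjacent v w = (v , w) ∈ edges G ⊎ (w , v) ∈ edges G

    atEnds : (V → V → ℤ) → V → V × V → ℤ
    atEnds f v (a , b) = mass a (f a b) v + mass b (f b a) v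

    nbrSum : (V → V → ℤ) → V → ℤ
    nbrSum f v = sumFin #E (λ i → atEnds f v (edge i))

    Δ≡nbrSum : ∀ φ v → Δ G φ v ≡ nbrSum (λ x y → φ x - φ y) v
    Δ≡nbrSum φ v = go (edges G)
      where
      go : ∀ es → Δ (record { n = n G ; edges = es }) φ v ≡
                  sumFin (length es) (λ i → atEnds (λ x y → φ x - φ y) v (lookup es i))
      go []       = refl
      go (e ∷ es) = cong (_+_ (atEnds (λ x y → φ x - φ y) v e)) (go es)

    nbrSum-+ : ∀ f g v → nbrSum (λ x y → f x y + g x y) v ≡ nbrSum f v + nbrSum g v
    nbrSum-+ f g v = trans (sumFin-cong #E (λ i → atEnds-+ (edge i))) (sumFin-+ #E _ _)
      where
      atEnds-+ : ∀ e → atEnds (λ x y → f x y + g x y) v e ≡ atEnds f v e + atEnds g v e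
      atEnds-+ (a , b) = trans (cong₂ _+_ (mass-+ a v (f a b) (g a b)) (mass-+ b v (f b a) (g b a)))
                               (interchange (mass a (f a b) v) (mass a (g a b) v) _ _)

    module _ {f g : V → V → ℤ} {v : V} where

      nbrSum-mono : (∀ w → f v w ≤ g v w) → nbrSum f v ≤ nbrSum g v
      nbrSum-mono f≤g = sumFin-mono #E λ i → atEnds-mono (edge i)
        where
        atEnds-mono : ∀ e → atEnds f v e ≤ atEnds g v e
        atEnds-mono (a , b) = ℤ.+-mono-≤ (mass-mono a v λ { refl → f≤g b })
                                         (mass-mono b v λ { refl → f≤g a })

      nbrSum-cong : (∀ w → f v w ≡ g v w) → nbrSum f v ≡ nbrSum g v
      nbrSum-cong f≡g = sumFin-cong #E λ i → atEnds-cong (edge i)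
        where
        atEnds-cong : ∀ e → atEnds f v e ≡ atEnds g v e
        atEnds-cong (a , b) = cong₂ _+_ (mass-cong a v λ { refl → f≡g b })
                                        (mass-cong b v λ { refl → f≡g a })

      nbrSum-cong-loopFree : LoopFree G → (∀ w → v ≢ w → f v w ≡ g v w) → nbrSum f v ≡ nbrSum g v
      nbrSum-cong-loopFree loopFree f≡g =
        sumFin-cong #E λ i → atEnds-cong (edge i) (All.lookup loopFree (∈-lookup i))
        where
        atEnds-cong : ∀ e → proj₁ e ≢ proj₂ e → atEnds f v e ≡ atEnds g v e
        atEnds-cong (a , b) a≢b = cong₂ _+_ (mass-cong a v λ { refl → f≡g b a≢b })
                                            (mass-cong b v λ { refl → f≡g a (a≢b ∘ sym) })

    nbrSum-*ˡ : ∀ c (f : V → V → ℤ) v → nbrSum (λ x y → c * f x y) v ≡ c * nbrSum f v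
    nbrSum-*ˡ c f v = trans (sumFin-cong #E (λ i → atEnds-* (edge i))) (sumFin-*ˡ #E c _)
      where
      atEnds-* : ∀ e → atEnds (λ x y → c * f x y) v e ≡ c * atEnds f v e
      atEnds-* (a , b) = trans (cong₂ _+_ (mass-*ˡ a v c _) (mass-*ˡ b v c _))
                               (sym (ℤ.*-distribˡ-+ c _ _))

    nbrSum-neg : ∀ f v → nbrSum (λ x y → - f x y) v ≡ - nbrSum f v
    nbrSum-neg f v = trans (nbrSum-cong (λ w → sym (ℤ.-1*i≡-i (f v w))))
                           (trans (nbrSum-*ˡ -[1+ 0 ] f v) (ℤ.-1*i≡-i _))

    nbrSum-zero : ∀ v → nbrSum (λ _ _ → + 0) v ≡ + 0
    nbrSum-zero v = trans (sumFin-cong #E (λ i → atEnds-zero (edge i))) (sumFin-zero #E)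
      where
      atEnds-zero : ∀ e → atEnds (λ _ _ → + 0) v e ≡ + 0
      atEnds-zero (a , b) = cong₂ _+_ (mass-zero a v) (mass-zero b v)

    module _ {f : V → V → ℤ} {v : V} (0≤f : ∀ w → + 0 ≤ f v w) where

      0≤atEnds : ∀ e → + 0 ≤ atEnds f v e
      0≤atEnds (a , b) = ℤ.+-mono-≤ (0≤mass a v λ { refl → 0≤f b }) (0≤mass b v λ { refl → 0≤f a })

      atEnds≤nbrSum : ∀ {e} → e ∈ edges G → atEnds f v e ≤ nbrSum f v
      atEnds≤nbrSum e∈E = subst (λ e → atEnds f v e ≤ nbrSum f v) (sym (lookup-index e∈E))
                                (term≤sumFin #E (0≤atEnds ∘ edge) (index e∈E))

      adjacent⇒≤nbrSum : ∀ {w} → Adjacent v w → f v w ≤ nbrSum f v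
      adjacent⇒≤nbrSum {w} (inj₁ vw∈E) = ℤ.≤-trans
        (subst (λ x → f v w ≤ x + mass w (f w v) v) (sym (mass-self v (f v w)))
               (i≤i+j _ (0≤mass w v λ { refl → 0≤f v })))
        (atEnds≤nbrSum vw∈E)
      adjacent⇒≤nbrSum {w} (inj₂ wv∈E) = ℤ.≤-trans
        (subst (λ x → f v w ≤ mass w (f w v) v + x) (sym (mass-self v (f v w)))
               (subst (f v w ≤_) (ℤ.+-comm (f v w) _) (i≤i+j _ (0≤mass w v {f w v} λ { refl → 0≤f v }))))
        (atEnds≤nbrSum wv∈E)

    bothEnds : (V → ℤ) → (V → V → ℤ) → V × V → ℤ
    bothEnds w f (a , b) = w a * f a b + w b * f b a

    handshake : ∀ (w : V → ℤ) f →
                sumFin (n G) (λ v → w v * nbrSum f v) ≡ sumFin #E (λ i → bothEnds w f (edge i))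
    handshake w f = begin
      sumFin (n G) (λ v → w v * nbrSum f v)
        ≡⟨ sumFin-cong (n G) (λ v → sym (sumFin-*ˡ #E (w v) _)) ⟩
      sumFin (n G) (λ v → sumFin #E (λ i → w v * atEnds f v (edge i)))
        ≡⟨ sumFin-comm (n G) #E _ ⟩
      sumFin #E (λ i → sumFin (n G) (λ v → w v * atEnds f v (edge i)))
        ≡⟨ sumFin-cong #E (λ i → onEdge (edge i)) ⟩
      sumFin #E (λ i → bothEnds w f (edge i)) ∎
      where
      open ≡-Reasoning
      onEdge : ∀ e → sumFin (n G) (λ v → w v * atEnds f v e) ≡ bothEnds w f e
      onEdge (a , b) = begin
        sumFin (n G) (λ v → w v * (mass a (f a b) v + mass b (f b a) v))
          ≡⟨ sumFin-cong (n G) (λ v → ℤ.*-distribˡ-+ (w v) _ _) ⟩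
        sumFin (n G) (λ v → w v * mass a (f a b) v + w v * mass b (f b a) v)
          ≡⟨ sumFin-+ (n G) _ _ ⟩
        sumFin (n G) (λ v → w v * mass a (f a b) v) + sumFin (n G) (λ v → w v * mass b (f b a) v)
          ≡⟨ cong₂ _+_ (sumFin-mass (n G) w a _) (sumFin-mass (n G) w b _) ⟩
        w a * f a b + w b * f b a ∎

    handshake₁ : ∀ f → sumFin (n G) (nbrSum f) ≡ sumFin #E (λ i → bothEnds (λ _ → + 1) f (edge i))
    handshake₁ f =
      trans (sumFin-cong (n G) (λ v → sym (ℤ.*-identityˡ (nbrSum f v)))) (handshake (λ _ → + 1) f)

    module _ {φ ψ : V → ℤ} {v : V} where

      Δ-+ : Δ G (λ u → φ u + ψ u) v ≡ Δ G φ v + Δ G ψ v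
      Δ-+ rewrite Δ≡nbrSum (λ u → φ u + ψ u) v | Δ≡nbrSum φ v | Δ≡nbrSum ψ v =
        trans (nbrSum-cong (λ w → regroup (φ v) (ψ v) (φ w) (ψ w)))
              (nbrSum-+ (λ x y → φ x - φ y) (λ x y → ψ x - ψ y) v)
        where
        regroup : ∀ a b c d → (a + b) - (c + d) ≡ (a - c) + (b - d)
        regroup = solve-∀

    Δ-*ˡ : ∀ c φ v → Δ G (λ u → c * φ u) v ≡ c * Δ G φ v
    Δ-*ˡ c φ v rewrite Δ≡nbrSum (λ u → c * φ u) v | Δ≡nbrSum φ v =
      trans (nbrSum-cong (λ w → factor c (φ v) (φ w))) (nbrSum-*ˡ c (λ x y → φ x - φ y) v)
      where
      factor : ∀ c a b → c * a - c * b ≡ c * (a - b)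
      factor = solve-∀

    Δ-neg : ∀ φ v → Δ G (λ u → - φ u) v ≡ - Δ G φ v
    Δ-neg φ v = trans (Δ≡nbrSum _ v) (trans (nbrSum-cong (λ w → flip (φ v) (φ w)))
                      (trans (nbrSum-neg (λ x y → φ x - φ y) v) (cong -_ (sym (Δ≡nbrSum φ v)))))
      where
      flip : ∀ a b → - a - - b ≡ - (a - b)
      flip = solve-∀

    Δ-const : ∀ c v → Δ G (λ _ → c) v ≡ + 0
    Δ-const c v = trans (Δ≡nbrSum _ v) (trans (nbrSum-cong (λ _ → ℤ.+-inverseʳ c)) (nbrSum-zero v))

    deg-Δ : ∀ φ → deg G (Δ G φ) ≡ + 0
    deg-Δ φ = begin
      sumFin (n G) (Δ G φ)
        ≡⟨ sumFin-cong (n G) (Δ≡nbrSum φ) ⟩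
      sumFin (n G) (nbrSum (λ x y → φ x - φ y))
        ≡⟨ handshake₁ (λ x y → φ x - φ y) ⟩
      sumFin #E (λ i → bothEnds (λ _ → + 1) (λ x y → φ x - φ y) (edge i))
        ≡⟨ sumFin-cong #E (λ i → cancel (edge i)) ⟩
      sumFin #E (λ _ → + 0)
        ≡⟨ sumFin-zero #E ⟩
      + 0 ∎
      where
      open ≡-Reasoning
      cancel : ∀ e → bothEnds (λ _ → + 1) (λ x y → φ x - φ y) e ≡ + 0
      cancel (a , b) = opposite (φ a) (φ b)
        where
        opposite : ∀ x y → + 1 * (x - y) + + 1 * (y - x) ≡ + 0
        opposite = solve-∀

    infix 4 _~_
    _~_ : Div G → Div G → Set
    _~_ = LinEq G

    ~-reflexive : ∀ {D D'} → (∀ v → D v ≡ D' v) → D ~ D'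
    ~-reflexive {D} {D'} D≗D' = (λ _ → + 0) , λ v → trans (ℤ.i≡j⇒i-j≡0 (D≗D' v)) (sym (Δ-const (+ 0) v))

    ~-refl : ∀ {D} → D ~ D
    ~-refl {D} = ~-reflexive {D} {D} (λ _ → refl)

    fire~ : ∀ D φ → (λ v → D v + Δ G φ v) ~ D
    fire~ D φ = φ , λ v → gain (D v) (Δ G φ v)
      where
      gain : ∀ a d → (a + d) - a ≡ d
      gain = solve-∀

    ~-sym : ∀ {D D'} → D ~ D' → D' ~ D
    ~-sym {D} {D'} (φ , D-D'≡Δφ) = (λ u → - φ u) , λ v → begin
      D' v - D v               ≡⟨ negate (D v) (D' v) ⟩
      - (D v - D' v)           ≡⟨ cong -_ (D-D'≡Δφ v) ⟩
      - Δ G φ v                ≡⟨ Δ-neg φ v ⟨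
      Δ G (λ u → - φ u) v      ∎
      where
      open ≡-Reasoning
      negate : ∀ a b → b - a ≡ - (a - b)
      negate = solve-∀

    ~-trans : ∀ {D D' D''} → D ~ D' → D' ~ D'' → D ~ D''
    ~-trans {D} {D'} {D''} (φ , D-D'≡Δφ) (ψ , D'-D''≡Δψ) = (λ u → φ u + ψ u) , λ v → begin
      D v - D'' v                  ≡⟨ telescope (D v) (D' v) (D'' v) ⟩
      (D v - D' v) + (D' v - D'' v) ≡⟨ cong₂ _+_ (D-D'≡Δφ v) (D'-D''≡Δψ v) ⟩
      Δ G φ v + Δ G ψ v            ≡⟨ Δ-+ ⟨
      Δ G (λ u → φ u + ψ u) v      ∎
      where
      open ≡-Reasoning
      telescope : ∀ a b c → a - c ≡ (a - b) + (b - c)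
      telescope = solve-∀

    ~-+ : ∀ {D₁ D₁' D₂ D₂'} → D₁ ~ D₁' → D₂ ~ D₂' →
          (λ v → D₁ v + D₂ v) ~ (λ v → D₁' v + D₂' v)
    ~-+ {D₁} {D₁'} {D₂} {D₂'} (φ , D₁≡) (ψ , D₂≡) = (λ u → φ u + ψ u) , λ v → begin
      (D₁ v + D₂ v) - (D₁' v + D₂' v)    ≡⟨ regroup (D₁ v) (D₂ v) (D₁' v) (D₂' v) ⟩
      (D₁ v - D₁' v) + (D₂ v - D₂' v)    ≡⟨ cong₂ _+_ (D₁≡ v) (D₂≡ v) ⟩
      Δ G φ v + Δ G ψ v                  ≡⟨ Δ-+ ⟨
      Δ G (λ u → φ u + ψ u) v            ∎
      where
      open ≡-Reasoning
      regroup : ∀ a b c d → (a + b) - (c + d) ≡ (a - c) + (b - d)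
      regroup = solve-∀

    ~-*ˡ : ∀ c {D D'} → D ~ D' → (λ v → c * D v) ~ (λ v → c * D' v)
    ~-*ˡ c {D} {D'} (φ , D≡) = (λ u → c * φ u) , λ v → begin
      c * D v - c * D' v    ≡⟨ factor c (D v) (D' v) ⟩
      c * (D v - D' v)      ≡⟨ cong (c *_) (D≡ v) ⟩
      c * Δ G φ v           ≡⟨ Δ-*ˡ c φ v ⟨
      Δ G (λ u → c * φ u) v ∎
      where
      open ≡-Reasoning
      factor : ∀ c a b → c * a - c * b ≡ c * (a - b)
      factor = solve-∀

    ~-sub : ∀ {D D' X X'} → D ~ D' → X ~ X' → (λ v → D v - X v) ~ (λ v → D' v - X' v)
    ~-sub {D} {D'} {X} {X'} (φ , D≡) (ψ , X≡) = (λ u → φ u - ψ u) , λ v → begin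
      (D v - X v) - (D' v - X' v)      ≡⟨ regroup (D v) (X v) (D' v) (X' v) ⟩
      (D v - D' v) - (X v - X' v)      ≡⟨ cong₂ _-_ (D≡ v) (X≡ v) ⟩
      Δ G φ v - Δ G ψ v                ≡⟨ cong (_+_ (Δ G φ v)) (Δ-neg ψ v) ⟨
      Δ G φ v + Δ G (λ u → - ψ u) v    ≡⟨ Δ-+ ⟨
      Δ G (λ u → φ u - ψ u) v          ∎
      where
      open ≡-Reasoning
      regroup : ∀ d x d' x' → (d - x) - (d' - x') ≡ (d - d') - (x - x')
      regroup = solve-∀

    ~-sumFin : ∀ k (c : Fin k → ℤ) {D D' : Fin k → Div G} → (∀ j → D j ~ D' j) →
               (λ v → sumFin k (λ j → c j * D j v)) ~ (λ v → sumFin k (λ j → c j * D' j v))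
    ~-sumFin zero    c D~D' = ~-reflexive {λ _ → + 0} {λ _ → + 0} (λ _ → refl)
    ~-sumFin (suc k) c {D} {D'} D~D' =
      ~-+ {λ v → c zero * D zero v} {λ v → c zero * D' zero v}
          (~-*ˡ (c zero) {D zero} {D' zero} (D~D' zero)) (~-sumFin k (c ∘ suc) (D~D' ∘ suc))

    ~-deg : ∀ {D D'} → D ~ D' → deg G D ≡ deg G D'
    ~-deg {D} {D'} (φ , D≡) = ℤ.i-j≡0⇒i≡j _ _ (begin
      deg G D - deg G D'                 ≡⟨ sumFin-sub (n G) D D' ⟨
      sumFin (n G) (λ v → D v - D' v)    ≡⟨ sumFin-cong (n G) D≡ ⟩
      deg G (Δ G φ)                      ≡⟨ deg-Δ φ ⟩
      + 0                                ∎)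
      where open ≡-Reasoning

    Nonempty : Div G → Set
    Nonempty = LinSysNonempty G

    Nonempty-resp-~ : ∀ {D D'} → Nonempty D → D ~ D' → Nonempty D'
    Nonempty-resp-~ {D} {D'} (E , E≥0 , E~D) D~D' = E , E≥0 , ~-trans {E} {D} {D'} E~D D~D'

    effective⇒Nonempty : ∀ {D} → Effective G D → Nonempty D
    effective⇒Nonempty {D} D≥0 = D , D≥0 , ~-reflexive {D} {D} (λ _ → refl)

    Nonempty⇒0≤deg : ∀ {D} → Nonempty D → + 0 ≤ deg G D
    Nonempty⇒0≤deg (E , E≥0 , E~D) = subst (+ 0 ≤_) (~-deg E~D) (sumFin-nonneg (n G) E≥0)

    pt : V → Div G
    pt a = mass a (+ 1)

    pt≥0 : ∀ a → Effective G (pt a)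
    pt≥0 a v = 0≤mass a v (λ _ → +≤+ z≤n)

    deg-pt : ∀ a → deg G (pt a) ≡ + 1
    deg-pt a = trans (sumFin-cong (n G) (λ v → sym (ℤ.*-identityˡ (pt a v))))
                     (sumFin-mass (n G) (λ _ → + 1) a (+ 1))

    deg-add-pt : ∀ {E k} a → deg G E ≡ + k → deg G (λ v → E v + pt a v) ≡ + suc k
    deg-add-pt {E} {k} a degE =
      trans (sumFin-+ (n G) E (pt a)) (trans (cong₂ _+_ degE (deg-pt a)) (cong +_ (ℕₚ.+-comm k 1)))

    deg-sub-pt : ∀ {E k} a → deg G E ≡ + suc k → deg G (λ v → E v - pt a v) ≡ + k
    deg-sub-pt {E} {k} a degE = trans (sumFin-sub (n G) E (pt a)) (trans (cong₂ _-_ degE (deg-pt a)) (drop (+ k)))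
      where
      drop : ∀ x → (+ 1 + x) - + 1 ≡ x
      drop = solve-∀

    sumFin-pt : ∀ (X : Div G) v → sumFin (n G) (λ w → X w * pt w v) ≡ X v
    sumFin-pt X v = trans
      (sumFin-single (n G) {λ w → X w * pt w v} v
        (λ w w≢v → trans (cong (X w *_) (mass-other (+ 1) w≢v)) (ℤ.*-zeroʳ (X w))))
      (trans (cong (X v *_) (mass-self v (+ 1))) (ℤ.*-identityʳ (X v)))

    allPoints~ : ∀ {F} → (∀ w → pt w ~ F) → ∀ X → X ~ (λ v → deg G X * F v)
    allPoints~ {F} pt~F X =
      ~-trans {X} {Σpt} step1
      (~-trans {Σpt} {ΣF} (~-sumFin (n G) X {pt} {λ _ → F} pt~F)
                          (~-reflexive {ΣF} {λ v → deg G X * F v} (λ v → sumFin-*ʳ (n G) X (F v))))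
      where
      Σpt ΣF : Div G
      Σpt v = sumFin (n G) (λ w → X w * pt w v)
      ΣF  v = sumFin (n G) (λ w → X w * F v)
      step1 : X ~ Σpt
      step1 = ~-reflexive {X} {Σpt} (λ v → sym (sumFin-pt X v))

    Nonempty-resp-≗ : ∀ {D D'} → (∀ v → D v ≡ D' v) → Nonempty D → Nonempty D'
    Nonempty-resp-≗ {D} {D'} D≗D' nonempty = Nonempty-resp-~ {D} {D'} nonempty (~-reflexive {D} {D'} D≗D')

    effective-+ : ∀ {E F} → Effective G E → Effective G F → Effective G (λ v → E v + F v)
    effective-+ E≥0 F≥0 v = ℤ.+-mono-≤ (E≥0 v) (F≥0 v)

    effective-deg0 : ∀ {E} → Effective G E → deg G E ≡ + 0 → ∀ v → E v ≡ + 0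
    effective-deg0 {E} E≥0 degE v =
      sym (sumFin-tight (n G) E≥0 (ℤ.≤-reflexive (trans degE (sym (sumFin-zero (n G))))) v)

    effective-point : ∀ {E k} → Effective G E → deg G E ≡ + suc k →
                      ∃[ a ] (Effective G (λ v → E v - pt a v) × deg G (λ v → E v - pt a v) ≡ + k)
    effective-point {E} {k} E≥0 degE with any? (λ a → + 1 ≤? E a)
    ... | yes (a , 1≤Ea) = a , remove , deg-sub-pt a degE
      where
      remove : Effective G (λ v → E v - pt a v)
      remove v with a ≟ v
      ... | yes refl = ℤ.i≤j⇒0≤j-i 1≤Ea
      ... | no _     = subst (+ 0 ≤_) (sym (ℤ.+-identityʳ (E v))) (E≥0 v)
    ... | no ¬1≤E = ⊥-elim (ℤ.<-irrefl refl (begin-strict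
      + 0                        <⟨ +<+ (s≤s z≤n) ⟩
      + suc k                    ≡⟨ degE ⟨
      deg G E                    ≤⟨ sumFin-mono (n G) E≤0 ⟩
      sumFin (n G) (λ _ → + 0)   ≡⟨ sumFin-zero (n G) ⟩
      + 0                        ∎))
      where
      open ℤ.≤-Reasoning
      E≤0 : ∀ a → E a ≤ + 0
      E≤0 a = ℤ.i<j⇒i≤pred[j] (ℤ.≰⇒> (¬1≤E ∘ (a ,_)))

    effective-deg1 : ∀ {E} → Effective G E → deg G E ≡ + 1 → ∃[ a ] (∀ v → E v ≡ pt a v)
    effective-deg1 {E} E≥0 degE with effective-point E≥0 degE
    ... | a , rest≥0 , deg-rest =
      a , λ v → ℤ.i-j≡0⇒i≡j (E v) (pt a v) (effective-deg0 rest≥0 deg-rest v)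

    effective-deg2 : ∀ {E} → Effective G E → deg G E ≡ + 2 →
                     ∃[ a ] ∃[ b ] (∀ v → E v ≡ pt a v + pt b v)
    effective-deg2 {E} E≥0 degE with effective-point E≥0 degE
    ... | a , rest≥0 , deg-rest with effective-deg1 rest≥0 deg-rest
    ...   | b , rest≡b = a , b , λ v → trans (split (E v) (pt a v)) (cong (_+_ (pt a v)) (rest≡b v))
      where
      split : ∀ e p → e ≡ p + (e - p)
      split = solve-∀

    deg1-rank≥1⇒pt~ : ∀ {D} → deg G D ≡ + 1 → RankProp G D 1 → ∀ w → pt w ~ D
    deg1-rank≥1⇒pt~ {D} degD rank w with rank (pt w) (pt≥0 w) (deg-pt w)
    ... | Z , Z≥0 , Z~D-w@(φ , Z-D+w≡Δφ) =
      φ , λ v → trans (swap (D v) (pt w v) (effective-deg0 Z≥0 degZ v)) (Z-D+w≡Δφ v)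
      where
      degZ : deg G Z ≡ + 0
      degZ = trans (~-deg {Z} {λ v → D v - pt w v} Z~D-w)
                   (trans (sumFin-sub (n G) D (pt w)) (cong₂ _-_ degD (deg-pt w)))
      swap : ∀ d p {z} → z ≡ + 0 → p - d ≡ z - (d - p)
      swap d p refl = negate d p
        where
        negate : ∀ d p → p - d ≡ + 0 - (d - p)
        negate = solve-∀

    Inhabited : (V → Bool) → Set
    Inhabited S = ∃[ v ] S v ≡ true

    outdeg : (V → Bool) → V → ℤ
    outdeg S = nbrSum (λ _ w → 𝟙 (not (S w)))

    Δ-𝟙-inside : ∀ S v → S v ≡ true → Δ G (𝟙 ∘ S) v ≡ outdeg S v
    Δ-𝟙-inside S v Sv = trans (Δ≡nbrSum (𝟙 ∘ S) v) (nbrSum-cong step)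
      where
      step : ∀ w → 𝟙 (S v) - 𝟙 (S w) ≡ 𝟙 (not (S w))
      step w rewrite Sv with S w
      ... | true  = refl
      ... | false = refl

    Δ-𝟙-outside : ∀ S v → S v ≡ false → Δ G (𝟙 ∘ S) v ≤ + 0
    Δ-𝟙-outside S v Sv = begin
      Δ G (𝟙 ∘ S) v              ≡⟨ Δ≡nbrSum (𝟙 ∘ S) v ⟩
      nbrSum (λ x y → 𝟙 (S x) - 𝟙 (S y)) v ≤⟨ nbrSum-mono step ⟩
      nbrSum (λ _ _ → + 0) v     ≡⟨ nbrSum-zero v ⟩
      + 0                        ∎
      where
      open ℤ.≤-Reasoning
      step : ∀ w → 𝟙 (S v) - 𝟙 (S w) ≤ + 0
      step w rewrite Sv with S w
      ... | true  = -≤+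
      ... | false = ℤ.≤-refl

    0≤outdeg : ∀ S v → + 0 ≤ outdeg S v
    0≤outdeg S v = subst (_≤ outdeg S v) (nbrSum-zero v) (nbrSum-mono (λ w → 0≤𝟙 (not (S w))))

    adjacent⇒1≤outdeg : ∀ S {v u} → Adjacent v u → S u ≡ false → + 1 ≤ outdeg S v
    adjacent⇒1≤outdeg S {v} adj Su =
      subst (λ s → 𝟙 (not s) ≤ outdeg S v) Su (adjacent⇒≤nbrSum (λ w → 0≤𝟙 (not (S w))) adj)

    -- Firing S from X would send some vertex of S into debt.
    Blocked : Div G → (V → Bool) → Set
    Blocked X S = ∃[ v ] (S v ≡ true × X v < outdeg S v)

    -- Apply the hypothesis to the set where the potential relating X to an effective divisor is minimal.
    allBlocked⇒empty : V → ∀ {X} → (∀ S → Inhabited S → Blocked X S) → ¬ Nonempty X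
    allBlocked⇒empty v₀ {X} blocked (E , E≥0 , φ , E-X≡Δφ) =
      impossible (blocked S (vmin , dec-true (φ vmin ≤? φ vmin) ℤ.≤-refl))
      where
      vmin : V
      vmin = argmin φ v₀ (allFin (n G))
      φ-min : ∀ u → φ vmin ≤ φ u
      φ-min u = All.lookup (f[argmin]≤f[xs] v₀ (allFin (n G))) (∈-allFin u)
      S : V → Bool
      S u = does (φ u ≤? φ vmin)
      impossible : Blocked X S → ⊥
      impossible (v , Sv , Xv<outdeg) = ℤ.<-irrefl refl (begin-strict
        - X v               ≡⟨ ℤ.+-identityˡ _ ⟨
        + 0 - X v           ≤⟨ ℤ.+-monoˡ-≤ (- X v) (E≥0 v) ⟩
        E v - X v           ≡⟨ E-X≡Δφ v ⟩
        Δ G φ v             ≡⟨ Δ≡nbrSum φ v ⟩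
        nbrSum (λ x y → φ x - φ y) v         ≤⟨ nbrSum-mono descent ⟩
        nbrSum (λ _ w → - 𝟙 (not (S w))) v   ≡⟨ nbrSum-neg (λ _ w → 𝟙 (not (S w))) v ⟩
        - outdeg S v        <⟨ ℤ.neg-mono-< Xv<outdeg ⟩
        - X v               ∎)
        where
        open ℤ.≤-Reasoning
        descent : ∀ w → φ v - φ w ≤ - 𝟙 (not (S w))
        descent w with S w in Sw
        ... | true  = ℤ.i≤j⇒i-j≤0 (ℤ.≤-trans (does-true (φ v ≤? φ vmin) Sv) (φ-min w))
        ... | false = i<j⇒i-j≤-1 (ℤ.≤-<-trans (does-true (φ v ≤? φ vmin) Sv)
                                             (ℤ.≰⇒> (does-false (φ w ≤? φ vmin) Sw)))

    sublevel-cut : ∀ ψ {x w} → Adjacent x w → ψ x < ψ w →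
                   sumFin (n G) (λ u → 𝟙 (does (ψ u ≤? ψ x)) * Δ G ψ u) ≤ ψ x - ψ w
    sublevel-cut ψ {x} {w} adj ψx<ψw = begin
      sumFin (n G) (λ u → 𝟙 (S u) * Δ G ψ u)
        ≡⟨ sumFin-cong (n G) (λ u → cong (𝟙 (S u) *_) (Δ≡nbrSum ψ u)) ⟩
      sumFin (n G) (λ u → 𝟙 (S u) * nbrSum f u)  ≡⟨ handshake (𝟙 ∘ S) f ⟩
      sumFin #E (λ i → bothEnds (𝟙 ∘ S) f (edge i)) ≤⟨ crossing adj ⟩
      ψ x - ψ w                                  ∎
      where
      open ℤ.≤-Reasoning
      S : V → Bool
      S u = does (ψ u ≤? ψ x)
      f : V → V → ℤ
      f a b = ψ a - ψ b
      Sx : S x ≡ true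
      Sx = dec-true (ψ x ≤? ψ x) ℤ.≤-refl
      Sw : S w ≡ false
      Sw = dec-false (ψ w ≤? ψ x) (ℤ.<⇒≱ ψx<ψw)
      below : ∀ a b → S a ≡ true → S b ≡ false → ψ a ≤ ψ b
      below a b Sa Sb =
        ℤ.<⇒≤ (ℤ.≤-<-trans (does-true (ψ a ≤? ψ x) Sa) (ℤ.≰⇒> (does-false (ψ b ≤? ψ x) Sb)))
      edge≤0 : ∀ e → bothEnds (𝟙 ∘ S) f e ≤ + 0
      edge≤0 (a , b) = 𝟙-cut (S a) (S b) (below a b) (below b a)
      total : ℤ
      total = sumFin #E (λ i → bothEnds (𝟙 ∘ S) f (edge i))
      atEdge : ∀ {e} → e ∈ edges G → total ≤ bothEnds (𝟙 ∘ S) f e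
      atEdge e∈E = subst (λ e → total ≤ bothEnds (𝟙 ∘ S) f e) (sym (lookup-index e∈E))
                         (sumFin≤term #E (edge≤0 ∘ edge) (index e∈E))
      crossing : Adjacent x w → total ≤ ψ x - ψ w
      crossing (inj₁ xw∈E) = subst (total ≤_) (𝟙-select Sx Sw) (atEdge xw∈E)
      crossing (inj₂ wx∈E) =
        subst (total ≤_) (trans (ℤ.+-comm (𝟙 (S w) * f w x) _) (𝟙-select Sx Sw)) (atEdge wx∈E)

    valence : V → ℤ
    valence = nbrSum (λ _ _ → + 1)

    uphill : (V → ℤ) → V → V → ℤ
    uphill ρ x y = 𝟙 (does (ρ x <? ρ y))

    -- The indegree divisor of the acyclic orientation that directs every edge towards its lower ρ-end.
    upDeg : (V → ℤ) → V → ℤ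
    upDeg ρ = nbrSum (uphill ρ)

    0≤upDeg : ∀ ρ v → + 0 ≤ upDeg ρ v
    0≤upDeg ρ v = subst (_≤ upDeg ρ v) (nbrSum-zero v) (nbrSum-mono (λ w → 0≤𝟙 (does (ρ v <? ρ w))))

    below-upDeg⇒allBlocked : ∀ {X} ρ → (∀ v → X v < upDeg ρ v) → ∀ S → Inhabited S → Blocked X S
    below-upDeg⇒allBlocked {X} ρ X<upDeg S (w₀ , Sw₀) =
      vmax , Svmax ,
      ℤ.<-≤-trans (X<upDeg vmax)
                  (nbrSum-mono {uphill ρ} {λ _ w → 𝟙 (not (S w))} (λ w → 𝟙≤𝟙 (up⇒out w)))
      where
      inS : List V
      inS = filter (λ u → S u ≟ᵇ true) (allFin (n G))
      vmax : V
      vmax = argmax ρ w₀ inS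
      Svmax : S vmax ≡ true
      Svmax = argmax-all ρ {P = λ u → S u ≡ true} Sw₀ (all-filter _ (allFin (n G)))
      ρ-max : ∀ u → S u ≡ true → ρ u ≤ ρ vmax
      ρ-max u Su = All.lookup (f[xs]≤f[argmax] w₀ inS) (∈-filter⁺ _ (∈-allFin u) Su)
      up⇒out : ∀ w → does (ρ vmax <? ρ w) ≡ true → not (S w) ≡ true
      up⇒out w up = sym (¬-not λ true≡Sw →
        ℤ.<-irrefl refl (ℤ.<-≤-trans (does-true (ρ vmax <? ρ w) up) (ρ-max w (sym true≡Sw))))

    uphill-bothEnds : ∀ ρ a b → bothEnds (λ _ → + 1) (uphill ρ) (a , b) ≡ uphill ρ a b + uphill ρ b a
    uphill-bothEnds ρ a b = cong₂ _+_ (ℤ.*-identityˡ (uphill ρ a b)) (ℤ.*-identityˡ (uphill ρ b a))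

    deg-upDeg≤#E : ∀ ρ → deg G (upDeg ρ) ≤ + #E
    deg-upDeg≤#E ρ = begin
      sumFin (n G) (upDeg ρ)                                   ≡⟨ handshake₁ (uphill ρ) ⟩
      sumFin #E (λ i → bothEnds (λ _ → + 1) (uphill ρ) (edge i)) ≤⟨ sumFin-mono #E (λ i → onEdge (edge i)) ⟩
      sumFin #E (λ _ → + 1)                                    ≡⟨ sumFin-one #E ⟩
      + #E                                                     ∎
      where
      open ℤ.≤-Reasoning
      onEdge : ∀ e → bothEnds (λ _ → + 1) (uphill ρ) e ≤ + 1
      onEdge (a , b) = subst (_≤ + 1) (sym (uphill-bothEnds ρ a b)) (𝟙[<]+𝟙[>]≤1 (ρ a) (ρ b))

    -- |E| - |V|, which is g - 1 on a connected graph (Defs' genus is truncated at 0).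
    genus-1 : ℤ
    genus-1 = + #E - + n G

    genus-1≡ : ∀ {g} → genus G ≡ suc g → genus-1 ≡ + g
    genus-1≡ {g} genus≡ = begin
      + #E - + n G              ≡⟨ cong (λ e → + e - + n G) #E≡ ⟩
      + (g ℕ.+ n G) - + n G     ≡⟨ cong (_- + n G) (ℤ.pos-+ g (n G)) ⟩
      + g + + n G - + n G       ≡⟨ cancel (+ g) (+ n G) ⟩
      + g                       ∎
      where
      open ≡-Reasoning
      cancel : ∀ a b → a + b - b ≡ a
      cancel = solve-∀
      n≤#E+1 : n G ℕ.≤ #E ℕ.+ 1
      n≤#E+1 = ℕₚ.<⇒≤ (ℕₚ.m∸n≢0⇒n<m (λ genus≡0 → ℕₚ.0≢1+n (trans (sym genus≡0) genus≡)))
      #E≡ : #E ≡ g ℕ.+ n G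
      #E≡ = ℕₚ.suc-injective
        (trans (ℕₚ.+-comm 1 #E) (trans (sym (ℕₚ.m∸n+n≡m n≤#E+1)) (cong (ℕ._+ n G) genus≡)))

    genus≡0⇒genus-1<0 : genus G ≡ 0 → genus-1 < + 0
    genus≡0⇒genus-1<0 genus≡0 =
      subst (genus-1 <_) (ℤ.+-inverseʳ (+ n G)) (ℤ.+-monoˡ-< (- + n G) (+<+ #E<n))
      where
      #E<n : #E ℕ.< n G
      #E<n = subst (ℕ._≤ n G) (ℕₚ.+-comm #E 1) (ℕₚ.m∸n≡0⇒m≤n genus≡0)

    K : Div G
    K v = valence v - + 2

    deg-K : deg G K ≡ genus-1 + genus-1
    deg-K = begin
      sumFin (n G) K                                              ≡⟨ sumFin-sub (n G) _ _ ⟩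
      deg G valence - sumFin (n G) (λ _ → + 2)
        ≡⟨ cong₂ _-_ (trans (handshake₁ _) (sumFin-const #E (+ 2))) (sumFin-const (n G) (+ 2)) ⟩
      + #E * + 2 - + n G * + 2                                    ≡⟨ twice (+ #E) (+ n G) ⟩
      genus-1 + genus-1                                           ∎
      where
      open ≡-Reasoning
      twice : ∀ e v → e * + 2 - v * + 2 ≡ (e - v) + (e - v)
      twice = solve-∀

    BelowOrientation : Div G → Set
    BelowOrientation X = ∃[ ρ ] (Injective _≡_ _≡_ ρ × (∀ v → X v < upDeg ρ v))

    belowOrientation⇒empty : V → ∀ {X} → BelowOrientation X → ¬ Nonempty X
    belowOrientation⇒empty v₀ (ρ , _ , X<upDeg) = allBlocked⇒empty v₀ (below-upDeg⇒allBlocked ρ X<upDeg)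

    belowOrientation⇒deg≤genus-1 : ∀ {X} → BelowOrientation X → deg G X ≤ genus-1
    belowOrientation⇒deg≤genus-1 {X} (ρ , _ , X<upDeg) = j+i≤k⇒i≤k-j {j = + n G} (begin
      + n G + deg G X                          ≡⟨ cong (_+ deg G X) (sumFin-one (n G)) ⟨
      sumFin (n G) (λ _ → + 1) + deg G X      ≡⟨ sumFin-+ (n G) (λ _ → + 1) X ⟨
      sumFin (n G) (λ v → + 1 + X v)          ≤⟨ sumFin-mono (n G) (λ v → ℤ.i<j⇒suc[i]≤j (X<upDeg v)) ⟩
      deg G (upDeg ρ)                         ≤⟨ deg-upDeg≤#E ρ ⟩
      + #E                                    ∎)
      where open ℤ.≤-Reasoning

    module _ (loopFree : LoopFree G) {ρ : V → ℤ} (ρ-inj : Injective _≡_ _≡_ ρ) where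

      deg-upDeg : deg G (upDeg ρ) ≡ + #E
      deg-upDeg = begin
        sumFin (n G) (upDeg ρ)                                     ≡⟨ handshake₁ (uphill ρ) ⟩
        sumFin #E (λ i → bothEnds (λ _ → + 1) (uphill ρ) (edge i)) ≡⟨ sumFin-cong #E onEdge ⟩
        sumFin #E (λ _ → + 1)                                      ≡⟨ sumFin-one #E ⟩
        + #E                                                       ∎
        where
        open ≡-Reasoning
        onEdge : ∀ i → bothEnds (λ _ → + 1) (uphill ρ) (edge i) ≡ + 1
        onEdge i with edge i | All.lookup loopFree (∈-lookup i)
        ... | a , b | a≢b = trans (uphill-bothEnds ρ a b) (𝟙[<]+𝟙[>]≡1 (a≢b ∘ ρ-inj))

      upDeg+upDeg⁻ : ∀ v → upDeg ρ v + upDeg (λ u → - ρ u) v ≡ valence v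
      upDeg+upDeg⁻ v = trans (sym (nbrSum-+ (uphill ρ) (uphill (λ u → - ρ u)) v))
        (nbrSum-cong-loopFree loopFree λ w v≢w →
          trans (cong (_+_ (uphill ρ v w)) (cong 𝟙 (does-neg-< (ρ v) (ρ w))))
                                               (𝟙[<]+𝟙[>]≡1 (v≢w ∘ ρ-inj)))

      below-upDeg-tight : ∀ {X} → (∀ v → X v < upDeg ρ v) → deg G X ≡ genus-1 →
                          ∀ v → + 1 + X v ≡ upDeg ρ v
      below-upDeg-tight {X} X<upDeg degX = sumFin-tight (n G) (λ v → ℤ.i<j⇒suc[i]≤j (X<upDeg v)) (begin
        deg G (upDeg ρ)                          ≡⟨ deg-upDeg ⟩
        + #E                                     ≡⟨ rearrange (+ #E) (+ n G) ⟩
        + n G + genus-1                          ≡⟨ cong₂ _+_ (sumFin-one (n G)) degX ⟨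
        sumFin (n G) (λ _ → + 1) + deg G X       ≡⟨ sumFin-+ (n G) (λ _ → + 1) X ⟨
        sumFin (n G) (λ v → + 1 + X v)           ∎)
        where
        open ℤ.≤-Reasoning
        rearrange : ∀ e v → e ≡ v + (e - v)
        rearrange = solve-∀

      -- K v = (upDeg ρ v - 1) + (upDeg (-ρ) v - 1), since reversing ρ reverses every edge.
      K-reverses-orientation : ∀ {X} → (∀ v → X v < upDeg ρ v) → deg G X ≡ genus-1 →
                               BelowOrientation (λ v → K v - X v)
      K-reverses-orientation {X} X<upDeg degX = (λ u → - ρ u) , ρ-inj ∘ ℤ.neg-injective , λ v →
        subst (_< upDeg (λ u → - ρ u) v) (sym (K-X≡ v)) (i-1<i _)
        where
        K-X≡ : ∀ v → K v - X v ≡ upDeg (λ u → - ρ u) v - + 1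
        K-X≡ v = begin
          K v - X v
            ≡⟨ cong (λ d → d - + 2 - X v) (upDeg+upDeg⁻ v) ⟨
          upDeg ρ v + upDeg (λ u → - ρ u) v - + 2 - X v
            ≡⟨ cong (λ d → d + upDeg (λ u → - ρ u) v - + 2 - X v) (below-upDeg-tight X<upDeg degX v) ⟨
          (+ 1 + X v) + upDeg (λ u → - ρ u) v - + 2 - X v
            ≡⟨ simplify (X v) (upDeg (λ u → - ρ u) v) ⟩
          upDeg (λ u → - ρ u) v - + 1
            ∎
          where
          open ≡-Reasoning
          simplify : ∀ x d → (+ 1 + x) + d - + 2 - x ≡ d - + 1
          simplify = solve-∀

    module Burning (q : V) where

      LegalFiring : Div G → (V → Bool) → Set
      LegalFiring E U = Inhabited U × U q ≡ false × (∀ v → U v ≡ true → outdeg U v ≤ E v)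

      BurningOrder : Div G → Set
      BurningOrder E = ∃[ ρ ] (Injective _≡_ _≡_ ρ × (∀ v → v ≢ q → E v < upDeg ρ v))

      private
        module _ (E : Div G) where

          -- S is the burnt set, ρ decreases with burning time, and all unburnt vertices
          -- share the value b, which lies below ρ on every burnt vertex.
          record Burnt (S : V → Bool) (ρ : V → ℤ) (b : ℤ) : Set where
            field
              root     : S q ≡ true
              unburnt  : ∀ v → S v ≡ false → ρ v ≡ b
              burnt    : ∀ v → S v ≡ true → b < ρ v
              distinct : ∀ {x y} → S x ≡ true → S y ≡ true → ρ x ≡ ρ y → x ≡ y
              deficit  : ∀ v → S v ≡ true → v ≢ q → E v < upDeg ρ v

          unburntCount : (V → Bool) → ℤ
          unburntCount S = sumFin (n G) (λ u → 𝟙 (not (S u)))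

          module Burn {S ρ b} (inv : Burnt S ρ b) (x : V) (Sx : S x ≡ false)
                      (Ex<out : E x < outdeg (not ∘ S) x) where
            open Burnt inv

            S′ : V → Bool
            S′ u = S u ∨ does (u ≟ x)

            ρ′ : V → ℤ
            ρ′ u = if S′ u then ρ u else b - + 1

            S′x : S′ x ≡ true
            S′x rewrite dec-true (x ≟ x) refl = ∨-zeroʳ (S x)

            S⊆S′ : ∀ {u} → S u ≡ true → S′ u ≡ true
            S⊆S′ Su rewrite Su = refl

            S′-split : ∀ u → S′ u ≡ true → S u ≡ true ⊎ u ≡ x
            S′-split u S′u with u ≟ x
            ... | yes u≡x = inj₂ u≡x
            ... | no _    = inj₁ (trans (sym (∨-identityʳ (S u))) S′u)

            ρ′-in : ∀ {u} → S′ u ≡ true → ρ′ u ≡ ρ u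
            ρ′-in S′u rewrite S′u = refl

            ρ′-out : ∀ {u} → S′ u ≡ false → ρ′ u ≡ b - + 1
            ρ′-out S′u rewrite S′u = refl

            b-1<b : b - + 1 < b
            b-1<b = i-1<i b

            ρx≡b : ρ x ≡ b
            ρx≡b = unburnt x Sx

            distinct′ : ∀ {u w} → S′ u ≡ true → S′ w ≡ true → ρ′ u ≡ ρ′ w → u ≡ w
            distinct′ {u} {w} S′u S′w ρ′u≡ρ′w with S′-split u S′u | S′-split w S′w
            ... | inj₁ Su   | inj₁ Sw   = distinct Su Sw ρu≡ρw
              where
              ρu≡ρw : ρ u ≡ ρ w
              ρu≡ρw = trans (sym (ρ′-in S′u)) (trans ρ′u≡ρ′w (ρ′-in S′w))
            ... | inj₁ Su   | inj₂ refl = ⊥-elim (ℤ.<-irrefl (sym (trans ρu≡b ρx≡b)) (burnt u Su))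
              where
              ρu≡b : ρ u ≡ ρ x
              ρu≡b = trans (sym (ρ′-in S′u)) (trans ρ′u≡ρ′w (ρ′-in S′w))
            ... | inj₂ refl | inj₁ Sw   = ⊥-elim (ℤ.<-irrefl (sym (trans ρw≡b ρx≡b)) (burnt w Sw))
              where
              ρw≡b : ρ w ≡ ρ x
              ρw≡b = trans (sym (ρ′-in S′w)) (trans (sym ρ′u≡ρ′w) (ρ′-in S′u))
            ... | inj₂ refl | inj₂ refl = refl

            same-uphill : ∀ {v} → S v ≡ true → ∀ w → uphill ρ′ v w ≡ uphill ρ v w
            same-uphill {v} Sv w = cong 𝟙 (does-⇔ (same-order (S′ w) refl) (ρ′ v <? ρ′ w) (ρ v <? ρ w))
              where
              ρ′v≡ρv : ρ′ v ≡ ρ v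
              ρ′v≡ρv = ρ′-in (S⊆S′ Sv)
              same-order : ∀ s → S′ w ≡ s → (ρ′ v < ρ′ w) ⇔ (ρ v < ρ w)
              same-order true  S′w =
                mk⇔ (subst₂ _<_ ρ′v≡ρv (ρ′-in S′w)) (subst₂ _<_ (sym ρ′v≡ρv) (sym (ρ′-in S′w)))
              same-order false S′w = mk⇔
                (λ lt → ⊥-elim (ℤ.<-asym lt
                  (subst₂ _<_ (sym (ρ′-out S′w)) (sym ρ′v≡ρv) (ℤ.<-trans b-1<b (burnt v Sv)))))
                (λ lt → ⊥-elim (ℤ.<-asym lt
                  (subst (_< ρ v) (sym (unburnt w (∨-conicalˡ (S w) _ S′w))) (burnt v Sv))))

            deficit′ : ∀ v → S′ v ≡ true → v ≢ q → E v < upDeg ρ′ v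
            deficit′ v S′v v≢q with S′-split v S′v
            ... | inj₁ Sv   = subst (E v <_) (sym (nbrSum-cong (same-uphill Sv))) (deficit v Sv v≢q)
            ... | inj₂ refl = ℤ.<-≤-trans Ex<out (nbrSum-mono {λ _ w → 𝟙 (not (not (S w)))} {uphill ρ′}
                                                              (λ w → 𝟙≤𝟙 (burnt⇒uphill w)))
              where
              burnt⇒uphill : ∀ w → not (not (S w)) ≡ true → does (ρ′ x <? ρ′ w) ≡ true
              burnt⇒uphill w ¬¬Sw = dec-true (ρ′ x <? ρ′ w)
                (subst₂ _<_ (sym (trans (ρ′-in S′x) ρx≡b)) (sym (ρ′-in (S⊆S′ Sw))) (burnt w Sw))
                where
                  Sw : S w ≡ true
                  Sw = trans (sym (not-involutive (S w))) ¬¬Sw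

            above-floor : ∀ v → S′ v ≡ true → b - + 1 < ρ v
            above-floor v S′v with S′-split v S′v
            ... | inj₁ Sv   = ℤ.<-trans b-1<b (burnt v Sv)
            ... | inj₂ refl = subst (b - + 1 <_) (sym ρx≡b) b-1<b

            inv′ : Burnt S′ ρ′ (b - + 1)
            inv′ = record
              { root     = S⊆S′ root
              ; unburnt  = λ v → ρ′-out
              ; burnt    = λ v S′v → subst (b - + 1 <_) (sym (ρ′-in S′v)) (above-floor v S′v)
              ; distinct = distinct′
              ; deficit  = deficit′
              }

            progress : unburntCount S′ < unburntCount S
            progress = sumFin-strict (n G) (λ u → 𝟙≤𝟙 (shrinks u)) x
                         (subst₂ (λ s t → 𝟙 (not s) < 𝟙 (not t)) (sym S′x) (sym Sx) (+<+ (ℕₚ.n<1+n 0)))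
              where
              shrinks : ∀ u → not (S′ u) ≡ true → not (S u) ≡ true
              shrinks u ¬S′u
                rewrite ∨-conicalˡ (S u) _ (trans (sym (not-involutive (S′ u))) (cong not ¬S′u)) = refl

          start : Burnt (λ u → does (u ≟ q)) (λ u → if does (u ≟ q) then + 0 else -[1+ 0 ]) -[1+ 0 ]
          start = record
            { root     = dec-true (q ≟ q) refl
            ; unburnt  = λ v S₀v → cong (if_then + 0 else -[1+ 0 ]) S₀v
            ; burnt    = λ v S₀v → subst (-[1+ 0 ] <_) (sym (cong (if_then + 0 else -[1+ 0 ]) S₀v)) -<+
            ; distinct = λ {x} {y} S₀x S₀y _ → trans (does-true (x ≟ q) S₀x) (sym (does-true (y ≟ q) S₀y))
            ; deficit  = λ v S₀v v≢q → ⊥-elim (v≢q (does-true (v ≟ q) S₀v))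
            }

          Outcome : Set
          Outcome = (∃[ U ] LegalFiring E U) ⊎ BurningOrder E

          State : Set
          State = (V → Bool) × (V → ℤ) × ℤ

          Burnt′ : State → Set
          Burnt′ (S , ρ , b) = Burnt S ρ b

          step : ∀ st → Burnt′ st →
                 Outcome ⊎ ∃[ st′ ] (Burnt′ st′ × unburntCount (proj₁ st′) < unburntCount (proj₁ st))
          step (S , ρ , b) inv with all? (λ v → S v ≟ᵇ true)
          ... | yes allBurnt =
            inj₁ (inj₂ (ρ , distinct (allBurnt _) (allBurnt _) , λ v → deficit v (allBurnt v)))
            where open Burnt inv
          ... | no notAll with any? (λ x → (S x ≟ᵇ false) ×-dec (E x <? outdeg (not ∘ S) x))
          ...   | yes (x , Sx , Ex<out) = inj₂ ((S′ , ρ′ , b - + 1) , inv′ , progress)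
            where open Burn inv x Sx Ex<out
          ...   | no noneBurns = inj₁ (inj₁ (not ∘ S , unburntExists , cong not root , legal))
            where
            open Burnt inv
            unburntExists : Inhabited (not ∘ S)
            unburntExists with ¬∀⟶∃¬ (n G) _ (λ v → S v ≟ᵇ true) notAll
            ... | v , Sv≢true = v , sym (¬-not (Sv≢true ∘ sym))
            legal : ∀ v → not (S v) ≡ true → outdeg (not ∘ S) v ≤ E v
            legal v ¬Sv = ℤ.≮⇒≥ λ Ev<out → noneBurns (v , Sv≡false , Ev<out)
              where
                Sv≡false : S v ≡ false
                Sv≡false = trans (sym (not-involutive (S v))) (cong not ¬Sv)

      burning : ∀ E → (∃[ U ] LegalFiring E U) ⊎ BurningOrder E
      burning E = proj₂ (proj₂ (descend (Burnt′ E) (λ _ → Outcome E) (unburntCount E ∘ proj₁)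
                                        (λ st _ → sumFin-nonneg (n G) (λ u → 0≤𝟙 (not (proj₁ st u))))
                                        (step E) _ (start E)))

    module Rooted (q : V) (conn : ∀ v → Reachable G v q) where

      Ball : ℕ → V → Set
      Ball zero    v = v ≡ q
      Ball (suc t) v = Ball t v ⊎ ∃[ u ] (Adjacent v u × Ball t u)

      adjacent? : ∀ v u → Dec (Adjacent v u)
      adjacent? v u = ((v , u) ∈? edges G) ⊎-dec ((u , v) ∈? edges G)

      ball? : ∀ t v → Dec (Ball t v)
      ball? zero    v = v ≟ q
      ball? (suc t) v = ball? t v ⊎-dec any? (λ u → adjacent? v u ×-dec ball? t u)

      reachable⇒ball : ∀ {v} → Reachable G v q → ∃[ t ] Ball t v
      reachable⇒ball here = 0 , refl
      reachable⇒ball (fwd {v = u} vu∈E r) with reachable⇒ball r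
      ... | t , u∈B = suc t , inj₂ (u , inj₁ vu∈E , u∈B)
      reachable⇒ball (bwd {v = u} uv∈E r) with reachable⇒ball r
      ... | t , u∈B = suc t , inj₂ (u , inj₂ uv∈E , u∈B)

      ball-+ : ∀ j {t v} → Ball t v → Ball (j ℕ.+ t) v
      ball-+ zero    v∈B = v∈B
      ball-+ (suc j) v∈B = inj₁ (ball-+ j v∈B)

      radius : ℕ
      radius = max 0 (map (proj₁ ∘ reachable⇒ball ∘ conn) (allFin (n G)))

      ball-radius : ∀ v → Ball radius v
      ball-radius v = subst (λ r → Ball r v) (ℕₚ.m∸n+n≡m t≤radius) (ball-+ (radius ℕ.∸ t) t-ball)
        where
        t : ℕ
        t = proj₁ (reachable⇒ball (conn v))
        t-ball : Ball t v
        t-ball = proj₂ (reachable⇒ball (conn v))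
        t≤radius : t ℕ.≤ radius
        t≤radius = All.lookup (xs≤max 0 _) (∈-map⁺ (proj₁ ∘ reachable⇒ball ∘ conn) (∈-allFin v))

      EffectiveOutside : ℕ → Div G → Set
      EffectiveOutside t E = ∀ v → ¬ Ball t v → + 0 ≤ E v

      -- Fire the complement of the ball of radius t often enough to pay every debt on its inner boundary.
      shrink : ∀ t {E} → EffectiveOutside (suc t) E → ∃[ E′ ] (E′ ~ E × EffectiveOutside t E′)
      shrink t {E} E≥0 = E′ , fire~ E ψ , E′≥0
        where
        Out : V → Bool
        Out u = not (does (ball? t u))
        c : ℤ
        c = sumFin (n G) (λ u → + ∣ E u ∣)
        0≤c : + 0 ≤ c
        0≤c = sumFin-nonneg (n G) (λ u → +≤+ z≤n)
        ψ : V → ℤ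
        ψ u = c * 𝟙 (Out u)
        E′ : Div G
        E′ v = E v + Δ G ψ v
        E′≥0 : ∀ v → ¬ Ball t v → + 0 ≤ E′ v
        E′≥0 v v∉B = subst (λ d → + 0 ≤ E v + d) (sym Δψ≡) (byDistance (ball? (suc t) v))
          where
          Δψ≡ : Δ G ψ v ≡ c * outdeg Out v
          Δψ≡ = trans (Δ-*ˡ c (𝟙 ∘ Out) v)
                      (cong (c *_) (Δ-𝟙-inside Out v (cong not (dec-false (ball? t v) v∉B))))
          byDistance : Dec (Ball (suc t) v) → + 0 ≤ E v + c * outdeg Out v
          byDistance (no v∉B′)                   = ℤ.+-mono-≤ (E≥0 v v∉B′) (0≤i*j 0≤c (0≤outdeg Out v))
          byDistance (yes (inj₁ v∈B))            = ⊥-elim (v∉B v∈B)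
          byDistance (yes (inj₂ (u , adj , u∈B))) = ℤ.≤-trans
            (-i≤j⇒0≤i+j (ℤ.≤-trans (-i≤∣i∣ (E v)) (term≤sumFin (n G) (λ u → +≤+ z≤n) v)))
            (ℤ.+-monoʳ-≤ (E v)
              (i≤i*j 0≤c (adjacent⇒1≤outdeg Out adj (cong not (dec-true (ball? t u) u∈B)))))

      effectiveOutside : ∀ j t → (∀ v → Ball (j ℕ.+ t) v) → ∀ D → ∃[ E ] (E ~ D × EffectiveOutside t E)
      effectiveOutside zero    t inBall D = D , ~-refl {D} , λ v v∉B → ⊥-elim (v∉B (inBall v))
      effectiveOutside (suc j) t inBall D
        with effectiveOutside j (suc t) (λ v → subst (λ r → Ball r v) (sym (ℕₚ.+-suc j t)) (inBall v)) D
      ... | E , E~D , E≥0 with shrink t E≥0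
      ...   | E′ , E′~E , E′≥0 = E′ , ~-trans {E′} {E} {D} E′~E E~D , E′≥0

      effectiveAwayFrom : ∀ D → ∃[ E ] (E ~ D × (∀ v → v ≢ q → + 0 ≤ E v))
      effectiveAwayFrom = effectiveOutside radius 0 λ v →
        subst (λ r → Ball r v) (sym (ℕₚ.+-identityʳ radius)) (ball-radius v)

      open Burning q using (LegalFiring; BurningOrder; burning)

      module Firing (E₀ : Div G) where

        C : ℤ
        C = sumFin (n G) (λ v → + ∣ E₀ v ∣)

        0≤C : + 0 ≤ C
        0≤C = sumFin-nonneg (n G) (λ v → +≤+ z≤n)

        after : (V → ℤ) → Div G
        after ψ v = E₀ v + Δ G ψ v

        record Valid (ψ : V → ℤ) : Set where
          field
            nonpos : ∀ u → ψ u ≤ + 0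
            root   : ψ q ≡ + 0
            offq   : ∀ v → v ≢ q → + 0 ≤ after ψ v

        module _ {ψ : V → ℤ} (valid : Valid ψ) where
          open Valid valid

          -- Summing E₀ + Δψ ≥ 0 over the sublevel set {ψ ≤ ψ x} bounds the rise of ψ
          -- along any edge leaving it.
          slope≤C : ∀ {x w} → Adjacent x w → ψ w - ψ x ≤ C
          slope≤C {x} {w} adj with ψ w ≤? ψ x
          ... | yes ψw≤ψx = ℤ.≤-trans (ℤ.i≤j⇒i-j≤0 ψw≤ψx) 0≤C
          ... | no ψw≰ψx = ℤ.0≤i-j⇒j≤i (subst (+ 0 ≤_) (swap C (ψ x) (ψ w)) (begin
            + 0                                         ≤⟨ sumFin-nonneg (n G) (λ u → 0≤𝟙* (S u) (away u)) ⟩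
            sumFin (n G) (λ u → 𝟙 (S u) * after ψ u)    ≡⟨ split ⟩
            sumFin (n G) (λ u → 𝟙 (S u) * E₀ u) + sumFin (n G) (λ u → 𝟙 (S u) * Δ G ψ u)
              ≤⟨ ℤ.+-mono-≤ (sumFin-mono (n G) (λ u → 𝟙*≤∣∣ (S u) (E₀ u)))
                            (sublevel-cut ψ adj ψx<ψw) ⟩
            C + (ψ x - ψ w)                             ∎))
            where
            open ℤ.≤-Reasoning
            ψx<ψw : ψ x < ψ w
            ψx<ψw = ℤ.≰⇒> ψw≰ψx
            S : V → Bool
            S u = does (ψ u ≤? ψ x)
            away : ∀ u → S u ≡ true → + 0 ≤ after ψ u
            away u Su = offq u λ { refl → ℤ.<-irrefl refl (begin-strict
              ψ q   ≤⟨ does-true (ψ q ≤? ψ x) Su ⟩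
              ψ x   <⟨ ψx<ψw ⟩
              ψ w   ≤⟨ nonpos w ⟩
              + 0   ≡⟨ root ⟨
              ψ q   ∎) }
            split : sumFin (n G) (λ u → 𝟙 (S u) * after ψ u) ≡
                    sumFin (n G) (λ u → 𝟙 (S u) * E₀ u) + sumFin (n G) (λ u → 𝟙 (S u) * Δ G ψ u)
            split = trans (sumFin-cong (n G) (λ u → ℤ.*-distribˡ-+ (𝟙 (S u)) (E₀ u) _)) (sumFin-+ (n G) _ _)
            swap : ∀ c a b → c + (a - b) ≡ c - (b - a)
            swap = solve-∀

          ball-bound : ∀ t {v} → Ball t v → + 0 ≤ ψ v + C * + t
          ball-bound zero    refl = ℤ.≤-reflexive (sym (cong₂ _+_ root (ℤ.*-zeroʳ C)))
          ball-bound (suc t) {v} (inj₁ v∈B) = begin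
            + 0                    ≤⟨ ball-bound t v∈B ⟩
            ψ v + C * + t          ≤⟨ ℤ.+-monoʳ-≤ (ψ v) (subst (_≤ C + C * + t) (ℤ.+-identityˡ _)
                                                              (ℤ.+-monoˡ-≤ (C * + t) 0≤C)) ⟩
            ψ v + (C + C * + t)    ≡⟨ cong (_+_ (ψ v)) (ℤ.*-suc C (+ t)) ⟨
            ψ v + C * + suc t      ∎
            where open ℤ.≤-Reasoning
          ball-bound (suc t) {v} (inj₂ (u , adj , u∈B)) = begin
            + 0                    ≤⟨ ball-bound t u∈B ⟩
            ψ u + C * + t          ≤⟨ ℤ.+-monoˡ-≤ (C * + t) (i-j≤k⇒i≤j+k {ψ u} {ψ v} (slope≤C adj)) ⟩
            ψ v + C + C * + t      ≡⟨ ℤ.+-assoc (ψ v) C (C * + t) ⟩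
            ψ v + (C + C * + t)    ≡⟨ cong (_+_ (ψ v)) (ℤ.*-suc C (+ t)) ⟨
            ψ v + C * + suc t      ∎
            where open ℤ.≤-Reasoning

        potential : (V → ℤ) → ℤ
        potential ψ = sumFin (n G) (λ v → ψ v + C * + radius)

        0≤potential : ∀ {ψ} → Valid ψ → + 0 ≤ potential ψ
        0≤potential valid = sumFin-nonneg (n G) (λ v → ball-bound valid radius (ball-radius v))

        module _ {ψ : V → ℤ} {U : V → Bool} (valid : Valid ψ) (legal : LegalFiring (after ψ) U) where
          open Valid valid

          fired : V → ℤ
          fired u = ψ u - 𝟙 (U u)

          after-fired : ∀ v → after fired v ≡ after ψ v - Δ G (𝟙 ∘ U) v
          after-fired v = begin
            E₀ v + Δ G fired v
              ≡⟨ cong (_+_ (E₀ v)) Δ-+ ⟩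
            E₀ v + (Δ G ψ v + Δ G (λ u → - 𝟙 (U u)) v)
              ≡⟨ cong (λ d → E₀ v + (Δ G ψ v + d)) (Δ-neg (𝟙 ∘ U) v) ⟩
            E₀ v + (Δ G ψ v - Δ G (𝟙 ∘ U) v)
              ≡⟨ ℤ.+-assoc (E₀ v) _ _ ⟨
            after ψ v - Δ G (𝟙 ∘ U) v
              ∎
            where open ≡-Reasoning

          fire-valid : Valid fired
          fire-valid = record
            { nonpos = λ u → ℤ.≤-trans (i-j≤i (ψ u) (0≤𝟙 (U u))) (nonpos u)
            ; root   = cong₂ _-_ root (cong 𝟙 (proj₁ (proj₂ legal)))
            ; offq   = λ v v≢q → subst (+ 0 ≤_) (sym (after-fired v)) (offq′ v v≢q (U v) refl)
            }
            where
            offq′ : ∀ v → v ≢ q → ∀ s → U v ≡ s → + 0 ≤ after ψ v - Δ G (𝟙 ∘ U) v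
            offq′ v _   true  Uv = ℤ.i≤j⇒0≤j-i (subst (_≤ after ψ v) (sym (Δ-𝟙-inside U v Uv))
                                                      (proj₂ (proj₂ legal) v Uv))
            offq′ v v≢q false Uv =
              ℤ.≤-trans (offq v v≢q) (i≤i+j (after ψ v) (ℤ.neg-mono-≤ (Δ-𝟙-outside U v Uv)))

          fire-decreases : potential fired < potential ψ
          fire-decreases = sumFin-strict (n G) (λ u → ℤ.+-monoˡ-≤ (C * + radius) (i-j≤i (ψ u) (0≤𝟙 (U u))))
            w (ℤ.+-monoˡ-< (C * + radius) (subst (λ s → ψ w - 𝟙 s < ψ w) (sym Uw) (i-1<i (ψ w))))
            where
            w : V
            w = proj₁ (proj₁ legal)
            Uw : U w ≡ true
            Uw = proj₂ (proj₁ legal)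

        settle : ∀ {ψ} → Valid ψ → ∃[ ψ′ ] (Valid ψ′ × BurningOrder (after ψ′))
        settle = descend Valid (BurningOrder ∘ after) potential (λ _ → 0≤potential) step _
          where
          step : ∀ ψ → Valid ψ →
                 BurningOrder (after ψ) ⊎ ∃[ ψ′ ] (Valid ψ′ × potential ψ′ < potential ψ)
          step ψ valid with burning (after ψ)
          ... | inj₂ order       = inj₁ order
          ... | inj₁ (U , legal) = inj₂ (fired valid legal , fire-valid valid legal , fire-decreases valid legal)

        reduceEffective : ∀ {D} → E₀ ~ D → (∀ v → v ≢ q → + 0 ≤ E₀ v) →
                          ∃[ E ] (E ~ D × (∀ v → v ≢ q → + 0 ≤ E v) × BurningOrder E)
        reduceEffective {D} E₀~D E₀≥0 = fromSettled (settle unfired)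
          where
          after-0 : ∀ v → after (λ _ → + 0) v ≡ E₀ v
          after-0 v = trans (cong (_+_ (E₀ v)) (Δ-const (+ 0) v)) (ℤ.+-identityʳ (E₀ v))
          unfired : Valid (λ _ → + 0)
          unfired = record
            { nonpos = λ _ → ℤ.≤-refl
            ; root   = refl
            ; offq   = λ v v≢q → subst (+ 0 ≤_) (sym (after-0 v)) (E₀≥0 v v≢q)
            }
          fromSettled : ∃[ ψ ] (Valid ψ × BurningOrder (after ψ)) →
                        ∃[ E ] (E ~ D × (∀ v → v ≢ q → + 0 ≤ E v) × BurningOrder E)
          fromSettled (ψ , valid , order) =
            after ψ , ~-trans {after ψ} {E₀} {D} (fire~ E₀ ψ) E₀~D , Valid.offq valid , order

      opaque
        reduce : ∀ D → ∃[ E ] (E ~ D × (∀ v → v ≢ q → + 0 ≤ E v) × BurningOrder E)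
        reduce D with effectiveAwayFrom D
        ... | E₀ , E₀~D , E₀≥0 = Firing.reduceEffective E₀ E₀~D E₀≥0

      nonempty⊎belowOrientation : ∀ D → Nonempty D ⊎ ∃[ E ] (E ~ D × BelowOrientation E)
      nonempty⊎belowOrientation D with reduce D
      ... | E , E~D , E≥0 , ρ , ρ-inj , E<upDeg with + 0 ≤? E q
      ...   | yes 0≤Eq = inj₁ (Nonempty-resp-~ {E} {D} (effective⇒Nonempty E-eff) E~D)
        where
        E-eff : Effective G E
        E-eff v with v ≟ q
        ... | yes refl = 0≤Eq
        ... | no v≢q   = E≥0 v v≢q
      ...   | no 0≰Eq = inj₂ (E , E~D , ρ , ρ-inj , E<upDeg′)
        where
        E<upDeg′ : ∀ v → E v < upDeg ρ v
        E<upDeg′ v with v ≟ q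
        ... | yes refl = ℤ.<-≤-trans (ℤ.≰⇒> 0≰Eq) (0≤upDeg ρ q)
        ... | no v≢q   = E<upDeg v v≢q

      Nonempty? : ∀ D → Dec (Nonempty D)
      Nonempty? D with nonempty⊎belowOrientation D
      ... | inj₁ nonempty           = yes nonempty
      ... | inj₂ (E , E~D , below) = no λ nonempty →
        belowOrientation⇒empty q below (Nonempty-resp-~ {D} {E} nonempty (~-sym {E} {D} E~D))

      genus-1<deg⇒Nonempty : ∀ {D} → genus-1 < deg G D → Nonempty D
      genus-1<deg⇒Nonempty {D} genus-1<degD with nonempty⊎belowOrientation D
      ... | inj₁ nonempty           = nonempty
      ... | inj₂ (E , E~D , below) =
        ⊥-elim (ℤ.≤⇒≯ (subst (_≤ genus-1) (~-deg {E} {D} E~D) (belowOrientation⇒deg≤genus-1 below))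
                      genus-1<degD)

      rank-suc⇒rank : ∀ {D k} → RankProp G D (suc k) → RankProp G D k
      rank-suc⇒rank {D} {k} rank E E≥0 degE
        with rank (λ v → E v + pt q v) (effective-+ E≥0 (pt≥0 q)) (deg-add-pt q degE)
      ... | F , F≥0 , F~ = (λ v → F v + pt q v) , effective-+ F≥0 (pt≥0 q) ,
        ~-trans {λ v → F v + pt q v} {λ v → (D v - (E v + pt q v)) + pt q v} {λ v → D v - E v}
          (~-+ {F} {λ v → D v - (E v + pt q v)} {pt q} {pt q} F~ (~-refl {pt q}))
          (~-reflexive {λ v → (D v - (E v + pt q v)) + pt q v} {λ v → D v - E v}
                       (λ v → restore (D v) (E v) (pt q v)))
        where
        restore : ∀ d e p → (d - (e + p)) + p ≡ d - e
        restore = solve-∀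

      rank-drop : ∀ {D k} w → RankProp G D (suc k) → RankProp G (λ v → D v - pt w v) k
      rank-drop {D} {k} w rank E E≥0 degE =
        Nonempty-resp-≗ {λ v → D v - (E v + pt w v)} {λ v → (D v - pt w v) - E v}
                        (λ v → reorder (D v) (E v) (pt w v))
        (rank (λ v → E v + pt w v) (effective-+ E≥0 (pt≥0 w)) (deg-add-pt w degE))
        where
        reorder : ∀ d e p → d - (e + p) ≡ (d - p) - e
        reorder = solve-∀

      rank-antimono : ∀ {D} k j → RankProp G D (j ℕ.+ k) → RankProp G D k
      rank-antimono k zero    rank = rank
      rank-antimono {D} k (suc j) rank = rank-antimono {D} k j (rank-suc⇒rank {D} rank)

      rank0⇒Nonempty : ∀ {D} → RankProp G D 0 → Nonempty D
      rank0⇒Nonempty {D} rank = Nonempty-resp-≗ {λ v → D v - + 0} {D} (λ v → ℤ.+-identityʳ (D v))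
                                                (rank (λ _ → + 0) (λ _ → ℤ.≤-refl) (sumFin-zero (n G)))

      rank≤deg : ∀ {D k} → RankProp G D k → + k ≤ deg G D
      rank≤deg {D} {k} rank =
        ℤ.0≤i-j⇒j≤i (subst (+ 0 ≤_) deg-rest (Nonempty⇒0≤deg {λ v → D v - kq v} (rank kq kq≥0 deg-kq)))
        where
        kq : Div G
        kq v = + k * pt q v
        kq≥0 : Effective G kq
        kq≥0 v = 0≤i*j {+ k} (+≤+ z≤n) (pt≥0 q v)
        deg-kq : deg G kq ≡ + k
        deg-kq = trans (sumFin-*ˡ (n G) (+ k) (pt q)) (trans (cong (+ k *_) (deg-pt q)) (ℤ.*-identityʳ (+ k)))
        deg-rest : deg G (λ v → D v - kq v) ≡ deg G D - + k
        deg-rest = trans (sumFin-sub (n G) D kq) (cong (_-_ (deg G D)) deg-kq)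

      HasRank≥1Of : ℕ → Set
      HasRank≥1Of d = ∃[ D ] (deg G D ≡ + d × RankProp G D 1)

      ¬HasRank≥1Of0 : ¬ HasRank≥1Of 0
      ¬HasRank≥1Of0 (D , degD , rank) = 1≰0 (subst (+ 1 ≤_) degD (rank≤deg {D} rank))
        where
        1≰0 : ¬ (+ 1 ≤ + 0)
        1≰0 (+≤+ ())

      rank≡1 : ∀ {d D} → deg G D ≡ + suc d → RankProp G D 1 → ¬ HasRank≥1Of d → RankEq G D 1
      rank≡1 {d} {D} degD rank ¬R = rank0⇒Nonempty {D} (rank-suc⇒rank {D} rank) , rank , atMost1
        where
        atMost1 : ∀ m → RankProp G D m → m ℕ.≤ 1
        atMost1 zero          _     = z≤n
        atMost1 (suc zero)    _     = s≤s z≤n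
        atMost1 (suc (suc m)) rank2 = ⊥-elim (¬R ((λ v → D v - pt q v) , deg-sub-pt q degD ,
          rank-drop {D} q (rank-antimono {D} 2 m (subst (RankProp G D) (ℕₚ.+-comm 2 m) rank2))))

      isGonality : ∀ d → HasRank≥1Of (suc d) →
                   (∀ d′ → 1 ℕ.≤ d′ → d′ ℕ.≤ d → ¬ HasRank≥1Of d′) → IsGonality G (suc d)
      isGonality d (D , degD , rank) smaller =
        s≤s z≤n , (D , degD , rank≡1 degD rank (below d ℕₚ.≤-refl)) , least
        where
        below : ∀ d′ → d′ ℕ.≤ d → ¬ HasRank≥1Of d′
        below zero     _    = ¬HasRank≥1Of0
        below (suc d′) d′<d = smaller (suc d′) (s≤s z≤n) d′<d
        least : ∀ d′ → 1 ℕ.≤ d′ → HasRank1Of G d′ → suc d ℕ.≤ d′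
        least d′ _ (D′ , degD′ , _ , rankD′ , _) with suc d ℕ.≤? d′
        ... | yes d<d′ = d<d′
        ... | no d≮d′  = ⊥-elim (below d′ (ℕₚ.≤-pred (ℕₚ.≰⇒> d≮d′)) (D′ , degD′ , rankD′))

      rank-by-degree : ∀ {D} k → genus-1 + + k < deg G D → RankProp G D k
      rank-by-degree {D} k bound E E≥0 degE = genus-1<deg⇒Nonempty (begin-strict
        genus-1                     ≡⟨ cancel genus-1 (+ k) ⟨
        genus-1 + + k - + k         <⟨ ℤ.+-monoˡ-< (- + k) bound ⟩
        deg G D - + k               ≡⟨ cong (_-_ (deg G D)) degE ⟨
        deg G D - deg G E           ≡⟨ sumFin-sub (n G) D E ⟨
        deg G (λ v → D v - E v)     ∎)
        where
        open ℤ.≤-Reasoning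
        cancel : ∀ l k → l + k - k ≡ l
        cancel = solve-∀

      Rank≥1Pair : Set
      Rank≥1Pair = ∃[ a ] ∃[ b ] (∀ w → Nonempty (λ v → (pt a v + pt b v) - pt w v))

      pair⇒HasRank≥1Of2 : Rank≥1Pair → HasRank≥1Of 2
      pair⇒HasRank≥1Of2 (a , b , nonempty) =
        D , trans (sumFin-+ (n G) (pt a) (pt b)) (cong₂ _+_ (deg-pt a) (deg-pt b)) , rank
        where
        D : Div G
        D v = pt a v + pt b v
        rank : RankProp G D 1
        rank E E≥0 degE with effective-deg1 E≥0 degE
        ... | w , E≗w = Nonempty-resp-≗ {λ v → D v - pt w v} {λ v → D v - E v}
                          (λ v → cong (_-_ (D v)) (sym (E≗w v))) (nonempty w)

      HasRank≥1Of2⇒pair : HasRank≥1Of 2 → Rank≥1Pair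
      HasRank≥1Of2⇒pair (D , degD , rank) = fromRepresentative (rank0⇒Nonempty {D} (rank-suc⇒rank {D} rank))
        where
        fromRepresentative : Nonempty D → Rank≥1Pair
        fromRepresentative (F₀ , F₀≥0 , F₀~D) =
          pairOf (effective-deg2 {F₀} F₀≥0 (trans (~-deg {F₀} {D} F₀~D) degD))
          where
          pairOf : ∃[ a ] ∃[ b ] (∀ v → F₀ v ≡ pt a v + pt b v) → Rank≥1Pair
          pairOf (a , b , F₀≗ab) = a , b , λ w →
            Nonempty-resp-≗ {λ v → F₀ v - pt w v} {λ v → (pt a v + pt b v) - pt w v}
                            (λ v → cong (_- pt w v) (F₀≗ab v))
              (Nonempty-resp-~ {λ v → D v - pt w v} {λ v → F₀ v - pt w v} (rank (pt w) (pt≥0 w) (deg-pt w))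
                               (~-sub {D} {F₀} {pt w} {pt w} (~-sym {F₀} {D} F₀~D) (~-refl {pt w})))

      HasRank≥1Of2? : Dec (HasRank≥1Of 2)
      HasRank≥1Of2? = Dec.map (mk⇔ pair⇒HasRank≥1Of2 HasRank≥1Of2⇒pair)
        (any? λ a → any? λ b → all? λ w → Nonempty? (λ v → (pt a v + pt b v) - pt w v))

      gonality-genus0 : genus G ≡ 0 → IsGonality G 1
      gonality-genus0 genus≡0 = isGonality 0 (pt q , deg-pt q , rank-by-degree {pt q} 1 bound) none
        where
        bound : genus-1 + + 1 < deg G (pt q)
        bound = subst (genus-1 + + 1 <_) (sym (deg-pt q)) (ℤ.+-monoˡ-< (+ 1) (genus≡0⇒genus-1<0 genus≡0))
        none : ∀ d′ → 1 ℕ.≤ d′ → d′ ℕ.≤ 0 → ¬ HasRank≥1Of d′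
        none (suc _) _ ()

      module _ (loopFree : LoopFree G) where

        -- Otherwise K - F reduces to some E strictly below an acyclic orientation, and then K - E,
        -- which is equivalent to F, lies below the reversed orientation.
        nonempty-K-F : ∀ {F} → Effective G F → deg G F ≡ genus-1 → Nonempty (λ v → K v - F v)
        nonempty-K-F {F} F≥0 degF with nonempty⊎belowOrientation (λ v → K v - F v)
        ... | inj₁ nonempty                          = nonempty
        ... | inj₂ (E , E~K-F , ρ , ρ-inj , E<upDeg) =
          ⊥-elim (belowOrientation⇒empty q (K-reverses-orientation loopFree ρ-inj E<upDeg degE)
                                            (Nonempty-resp-~ {F} {K-E} (effective⇒Nonempty F≥0) F~K-E))
          where
          K-E : Div G
          K-E v = K v - E v
          degE : deg G E ≡ genus-1
          degE = begin
            deg G E                                  ≡⟨ ~-deg {E} {λ v → K v - F v} E~K-F ⟩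
            sumFin (n G) (λ v → K v - F v)           ≡⟨ sumFin-sub (n G) K F ⟩
            deg G K - deg G F                        ≡⟨ cong₂ _-_ deg-K degF ⟩
            (genus-1 + genus-1) - genus-1            ≡⟨ cancel genus-1 ⟩
            genus-1                                  ∎
            where
            open ≡-Reasoning
            cancel : ∀ l → (l + l) - l ≡ l
            cancel = solve-∀
          F~K-E : F ~ K-E
          F~K-E = ~-trans {F} {λ v → K v - (K v - F v)} {K-E}
            (~-reflexive {F} {λ v → K v - (K v - F v)} (λ v → sym (twice-minus (K v) (F v))))
            (~-sym {K-E} {λ v → K v - (K v - F v)} (~-sub {K} {K} {E} {λ v → K v - F v} (~-refl {K}) E~K-F))
            where
            twice-minus : ∀ k f → k - (k - f) ≡ f
            twice-minus = solve-∀

        canonical-rank : ∀ {F₀} k → Effective G F₀ → deg G F₀ + + k ≡ genus-1 →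
                         RankProp G (λ v → K v - F₀ v) k
        canonical-rank {F₀} k F₀≥0 degF₀ E E≥0 degE =
          Nonempty-resp-≗ {λ v → K v - (F₀ v + E v)} {λ v → (K v - F₀ v) - E v}
                          (λ v → reorder (K v) (F₀ v) (E v))
            (nonempty-K-F (effective-+ F₀≥0 E≥0)
                          (trans (sumFin-+ (n G) F₀ E) (trans (cong (_+_ (deg G F₀)) degE) degF₀)))
          where
          reorder : ∀ c f e → c - (f + e) ≡ (c - f) - e
          reorder = solve-∀

        -- Such a divisor makes all points equivalent, so the orientation divisor minus one, of degree
        -- g - 1 ≥ 0, would be equivalent to an effective divisor.
        ¬HasRank≥1Of1 : + 0 ≤ genus-1 → ¬ HasRank≥1Of 1
        ¬HasRank≥1Of1 0≤genus-1 (D , degD , rank) with rank0⇒Nonempty {D} (rank-suc⇒rank {D} rank)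
        ... | F₀ , F₀≥0 , F₀~D = belowOrientation⇒empty q (τ , τ-inj , λ v → i-1<i (upDeg τ v))
          (Nonempty-resp-~ {gF₀} {X} (effective⇒Nonempty gF₀≥0) (~-sym {X} {gF₀} X~gF₀))
          where
          τ : V → ℤ
          τ v = + toℕ v
          τ-inj : Injective _≡_ _≡_ τ
          τ-inj = toℕ-injective ∘ ℤ.+-injective
          X gF₀ : Div G
          X v   = upDeg τ v - + 1
          gF₀ v = genus-1 * F₀ v
          gF₀≥0 : Effective G gF₀
          gF₀≥0 v = 0≤i*j 0≤genus-1 (F₀≥0 v)
          degX : deg G X ≡ genus-1
          degX = trans (sumFin-sub (n G) (upDeg τ) (λ _ → + 1))
                       (cong₂ _-_ (deg-upDeg loopFree τ-inj) (sumFin-one (n G)))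
          X~gF₀ : X ~ gF₀
          X~gF₀ = subst (λ c → X ~ (λ v → c * F₀ v)) degX
                        (allPoints~ (λ w → ~-trans {pt w} {D} {F₀} (deg1-rank≥1⇒pt~ degD rank w)
                                                   (~-sym {F₀} {D} F₀~D)) X)

        noRank≥1Below2 : + 0 ≤ genus-1 → ∀ d′ → 1 ℕ.≤ d′ → d′ ℕ.≤ 1 → ¬ HasRank≥1Of d′
        noRank≥1Below2 0≤genus-1 (suc zero)    _ _         = ¬HasRank≥1Of1 0≤genus-1
        noRank≥1Below2 0≤genus-1 (suc (suc _)) _ (s≤s ())

        gonality-genus1 : genus G ≡ 1 → IsGonality G 2
        gonality-genus1 genus≡1 =
          isGonality 1 (D , degD , rank-by-degree {D} 1 bound) (noRank≥1Below2 (ℤ.≤-reflexive (sym genus-1≡0)))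
          where
          genus-1≡0 : genus-1 ≡ + 0
          genus-1≡0 = genus-1≡ genus≡1
          D : Div G
          D v = pt q v + pt q v
          degD : deg G D ≡ + 2
          degD = trans (sumFin-+ (n G) (pt q) (pt q)) (cong₂ _+_ (deg-pt q) (deg-pt q))
          bound : genus-1 + + 1 < deg G D
          bound = subst₂ (λ l d → l + + 1 < d) (sym genus-1≡0) (sym degD) (+<+ (s≤s (s≤s z≤n)))

        gonality-genus2 : genus G ≡ 2 → IsGonality G 2
        gonality-genus2 genus≡2 =
          isGonality 1 (K-0 , degK-0 , canonical-rank {λ _ → + 0} 1 (λ _ → ℤ.≤-refl) deg0+1)
                       (noRank≥1Below2 (subst (+ 0 ≤_) (sym genus-1≡1) (+≤+ z≤n)))
          where
          genus-1≡1 : genus-1 ≡ + 1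
          genus-1≡1 = genus-1≡ genus≡2
          K-0 : Div G
          K-0 v = K v - + 0
          degK-0 : deg G K-0 ≡ + 2
          degK-0 = trans (sumFin-sub (n G) K (λ _ → + 0))
                         (cong₂ _-_ (trans deg-K (cong₂ _+_ genus-1≡1 genus-1≡1)) (sumFin-zero (n G)))
          deg0+1 : deg G (λ _ → + 0) + + 1 ≡ genus-1
          deg0+1 = trans (cong (_+ + 1) (sumFin-zero (n G))) (sym genus-1≡1)

        gonality-genus3 : genus G ≡ 3 → IsGonality G 2 ⊎ IsGonality G 3
        gonality-genus3 genus≡3 = byDegree2 HasRank≥1Of2?
          where
          genus-1≡2 : genus-1 ≡ + 2
          genus-1≡2 = genus-1≡ genus≡3
          0≤genus-1 : + 0 ≤ genus-1
          0≤genus-1 = subst (+ 0 ≤_) (sym genus-1≡2) (+≤+ z≤n)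
          K-q : Div G
          K-q v = K v - pt q v
          degK-q : deg G K-q ≡ + 3
          degK-q = trans (sumFin-sub (n G) K (pt q))
                         (cong₂ _-_ (trans deg-K (cong₂ _+_ genus-1≡2 genus-1≡2)) (deg-pt q))
          degq+1 : deg G (pt q) + + 1 ≡ genus-1
          degq+1 = trans (cong (_+ + 1) (deg-pt q)) (sym genus-1≡2)
          byDegree2 : Dec (HasRank≥1Of 2) → IsGonality G 2 ⊎ IsGonality G 3
          byDegree2 (yes rank2) = inj₁ (isGonality 1 rank2 (noRank≥1Below2 0≤genus-1))
          byDegree2 (no ¬rank2) =
            inj₂ (isGonality 2 (K-q , degK-q , canonical-rank {pt q} 1 (pt≥0 q) degq+1) excluded)
            where
            excluded : ∀ d′ → 1 ℕ.≤ d′ → d′ ℕ.≤ 2 → ¬ HasRank≥1Of d′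
            excluded (suc zero)          _ _               = ¬HasRank≥1Of1 0≤genus-1
            excluded (suc (suc zero))    _ _               = ¬rank2
            excluded (suc (suc (suc _))) _ (s≤s (s≤s ()))

        gonality-bound : ∀ g → genus G ≡ g → g ℕ.≤ 3 →
                         Σ ℕ (λ d → IsGonality G d × d ℕ.≤ (g ℕ.+ 3) / 2)
        gonality-bound 0 genus≡ _ = 1 , gonality-genus0 genus≡ , ℕₚ.≤-refl
        gonality-bound 1 genus≡ _ = 2 , gonality-genus1 genus≡ , ℕₚ.≤-refl
        gonality-bound 2 genus≡ _ = 2 , gonality-genus2 genus≡ , ℕₚ.≤-refl
        gonality-bound 3 genus≡ _ = atMost3 (gonality-genus3 genus≡)
          where
          atMost3 : IsGonality G 2 ⊎ IsGonality G 3 → Σ ℕ (λ d → IsGonality G d × d ℕ.≤ 3)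
          atMost3 (inj₁ gonality2) = 2 , gonality2 , ℕₚ.n≤1+n 2
          atMost3 (inj₂ gonality3) = 3 , gonality3 , ℕₚ.≤-refl
        gonality-bound (suc (suc (suc (suc _)))) _ (s≤s (s≤s (s≤s ())))

open import Data.Nat using (ℕ; _≤_; _+_)
open import Data.Nat.DivMod using (_/_)
open import Data.Product using (Σ; _×_; _,_)
open import Data.Fin using (Fin; fromℕ<)
open import Relation.Binary.PropositionalEquality using (refl)

lemma3p11 : (G : Graph) → LoopFree G → Connected G → genus G ≤ 3 →
    Σ ℕ (λ d → IsGonality G d × d ≤ (genus G + 3) / 2)
lemma3p11 G loopFree (1≤n , reachable) genus≤3 = gonality-bound loopFree (genus G) refl genus≤3
  where
  open ChipFiring.Divisors G
  q : Fin (n G)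
  q = fromℕ< 1≤n
  toRoot : ∀ v → Reachable G v q
  toRoot v = reachable v q
  open Rooted q toRoot
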